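{- Let $G$ be a cycle with root $r$ and edge weights $\gamma,\tau:E(G)\to\mathbb{R}$, and let $e_1\in E(G)$ be such that $T_1=G-e_1$ is a cable-trench tree of $G$. Let $v_1,\dots,v_n$ be distinct vertices of $G$ with $v_i\neq r$, and for each $i$ let $H_{v_i}$ be a graph with root $r_{H_{v_i}}$, edge weights $\gamma,\tau$, and cable-trench tree $S_i$. Form the wedge $G\wedge H_{v_1}\wedge\dots\wedge H_{v_n}$ by identifying each $v_i$ with $r_{H_{v_i}}$ (the $H_{v_i}$ otherwise vertex-disjoint from $G$ and from each other), rooted at $r$, with inherited weights. Suppose that for every edge $e_2\in E(G)$ with $e_2\neq e_1$, $$0\geq \tau(e_2)-\tau(e_1)+L(P_2)-L(P_1)+\big(L(P_2)-L(P_1)\big)|\tilde Q|+C(\tilde Q^+)-C(\tilde Q^-)+\sum_{v\in H(\tilde Q)}\big(L(R_1^{(v)})-L(R_2^{(v)})\big)|H_v|,$$ where all quantities are defined (depending on $e_2$) in the context. Then $T_1\wedge S_1\wedge\dots\wedge S_n$ is a cable-trench tree of $G\wedge H_{v_1}\wedge\dots\wedge H_{v_n}$.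
   Context: For a connected rooted graph with root $r$ and edge weights $\gamma,\tau$, the cost of a spanning tree $T$ is $\mathrm{cost}(T)=\sum_{e\in E(T)}\tau(e)+\sum_{w}\sum_{e\in P_T(r,w)}\gamma(e)$, where $P_T(r,w)$ is the unique $r$–$w$ path in $T$; a cable-trench tree is a spanning tree of minimum cost. For spanning trees $T$ of $G$ and $S_i$ of $H_{v_i}$, $T\wedge S_1\wedge\dots\wedge S_n$ denotes the spanning tree of the wedge with edge set $E(T)\cup\bigcup_i E(S_i)$. For a path $P$ with edges $(f_1,\dots,f_k)$ listed in order of traversal, $|P|=k$, $L(P)=\sum_{i=1}^k\gamma(f_i)$ and $C(P)=\sum_{i=1}^k\sum_{j=1}^i\gamma(f_j)$. Given distinct $e_1,e_2\in E(G)$: deleting $e_1,e_2$ from the cycle leaves two paths; let $\tilde Q$ be the one not containing $r$ (possibly a single vertex). $P_1$ is the path starting at $r$ and running along the cycle, in the direction in which $e_1$ is met before $e_2$, up to and including $e_1$; $P_2$ is defined symmetrically with $e_2$. $\tilde Q^+$ is $\tilde Q$ traversed from its endpoint incident to $e_2$ to its endpoint incident to $e_1$, and $\tilde Q^-$ is the reverse traversal. For $i=1,2$ and a vertex $v\neq r$ of $G$, $R_i^{(v)}$ is the $r$–$v$ path in $G$ not containing $e_i$, oriented from $r$. $H(\tilde Q)$ is the set of wedge vertices $v_j$ lying on $\tilde Q$, and for $v=v_j$, $H_v=H_{v_j}$ and $|H_v|=|V(H_{v_j})|-1$ (the number of vertices of $H_{v_j}$ other than its root). -}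

module Defs where

open import Level using (0ℓ)
open import Data.Nat using (ℕ; zero; suc)
open import Data.Fin using (Fin; zero; suc)
open import Data.Fin.Properties using () renaming (_≟_ to _≟F_)
open import Data.Bool using (Bool; true; false; not; _∧_; if_then_else_)
import Data.Bool
open import Data.Maybe using (Maybe; just; nothing)
import Data.Maybe as Maybe
open import Data.Maybe.Properties using () renaming (≡-dec to ≡-decM)
open import Data.Product using (Σ; _×_; _,_; proj₁; proj₂; swap)
open import Data.Sum using (_⊎_; inj₁; inj₂; [_,_])
open import Data.List using (List; []; _∷_; map; _++_; concatMap; allFin; upTo; take; length)
open import Data.List.Membership.Propositional using (_∈_)
open import Data.List.Relation.Unary.Unique.Propositional using (Unique)
open import Algebra.Core using (Op₁; Op₂)
open import Algebra.Structures using (IsAbelianGroup)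
open import Relation.Binary.Core using (Rel)
open import Relation.Binary.Structures using (IsTotalOrder)
open import Relation.Binary.PropositionalEquality using (_≡_; _≢_)
open import Relation.Nullary.Decidable using (⌊_⌋)

-- Weights: a totally ordered abelian group (ℝ with + and ≤ is an instance).

record OrderedAbelianGroup : Set₁ where
  infixl 6 _+_ _-_
  infix 4 _≈_ _≤_
  field
    Carrier        : Set
    _≈_            : Rel Carrier 0ℓ
    _≤_            : Rel Carrier 0ℓ
    _+_            : Op₂ Carrier
    0#             : Carrier
    -_             : Op₁ Carrier
    isAbelianGroup : IsAbelianGroup _≈_ _+_ 0# -_
    isTotalOrder   : IsTotalOrder _≈_ _≤_
    +-monoˡ-≤      : ∀ {x y} z → x ≤ y → x + z ≤ y + z

  _-_ : Op₂ Carrier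
  x - y = x + (- y)

  _·_ : ℕ → Carrier → Carrier
  zero  · x = 0#
  suc n · x = x + (n · x)

  sumA : List Carrier → Carrier
  sumA []       = 0#
  sumA (x ∷ xs) = x + sumA xs

-- Finite rooted graphs.  Vertex type  Maybe W : the root is  nothing,
-- the non-root vertices are  just w  (w : W).  Edges are unordered:
-- ends e  lists the two endpoints in some order.

record RGraph : Set₁ where
  field
    W       : Set
    E       : Set
    ends    : E → Maybe W × Maybe W
    nonroot : List W
    edges   : List E

  Vx : Set
  Vx = Maybe W

  root : Vx
  root = nothing

  verts : List Vx
  verts = nothing ∷ map just nonroot

open RGraph public

WellFormed : RGraph → Set
WellFormed G = ((w : W G) → w ∈ nonroot G) × Unique (nonroot G)
             × ((e : E G) → e ∈ edges G) × Unique (edges G)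

Simple : RGraph → Set
Simple G = ((e : E G) → proj₁ (ends G e) ≢ proj₂ (ends G e))
         × ((e e′ : E G) → (ends G e ≡ ends G e′ ⊎ ends G e ≡ swap (ends G e′)) → e ≡ e′)

module _ (G : RGraph) where
  Joins : E G → Vx G → Vx G → Set
  Joins e u x = ends G e ≡ (u , x) ⊎ ends G e ≡ (x , u)

  data Walk (T : E G → Bool) : Vx G → Vx G → Set where
    []   : ∀ {u} → Walk T u u
    step : ∀ {u x w} (e : E G) → T e ≡ true → Joins e u x → Walk T x w → Walk T u w

  module _ {T : E G → Bool} where
    vertsW : ∀ {u w} → Walk T u w → List (Vx G)
    vertsW ([] {u})          = u ∷ []
    vertsW (step {u} _ _ _ p) = u ∷ vertsW p

    edgesW : ∀ {u w} → Walk T u w → List (E G)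
    edgesW []               = []
    edgesW (step e _ _ p)   = e ∷ edgesW p

  IsPath : ∀ {T u w} → Walk T u w → Set
  IsPath p = Unique (vertsW p)

  IsSpanningTree : (E G → Bool) → Set
  IsSpanningTree T =
      ((u w : Vx G) → Σ (Walk T u w) IsPath)
    × ((u w : Vx G) (p q : Walk T u w) → IsPath p → IsPath q → edgesW p ≡ edgesW q)

  allE : E G → Bool
  allE _ = true

module _ (A : OrderedAbelianGroup) where
  open OrderedAbelianGroup A

  -- L(P) and C(P) for a path given by its edge list in traversal order
  Lw : {X : Set} → (X → Carrier) → List X → Carrier
  Lw γ es = sumA (map γ es)

  Cw : {X : Set} → (X → Carrier) → List X → Carrier
  Cw γ es = sumA (map (λ i → Lw γ (take (suc i) es)) (upTo (length es)))

  cost : (G : RGraph) (γ τ : E G → Carrier) (T : E G → Bool) → IsSpanningTree G T → Carrier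
  cost G γ τ T st =
      sumA (map (λ e → if T e then τ e else 0#) (edges G))
    + sumA (map (λ w → Lw γ (edgesW G (proj₁ (proj₁ st (root G) w)))) (verts G))

  IsCableTrench : (G : RGraph) (γ τ : E G → Carrier) → (E G → Bool) → Set
  IsCableTrench G γ τ T =
    Σ (IsSpanningTree G T) λ st →
      (T′ : E G → Bool) (st′ : IsSpanningTree G T′) → cost G γ τ T st ≤ cost G γ τ T′ st′

-- The cycle on  suc m  vertices, rooted.  Vertex  i : Fin (suc m)  is
-- toV i  (vertex 0 is the root), and edge  i  joins vertex i and vertex i+1 (mod suc m).

toV : ∀ {m} → Fin (suc m) → Maybe (Fin m)
toV zero    = nothing
toV (suc i) = just i

nxt : ∀ {m} → Fin (suc m) → Maybe (Fin m)
nxt {zero}  zero    = nothing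
nxt {suc m} zero    = just zero
nxt {suc m} (suc i) = Maybe.map suc (nxt {m} i)

cycleGraph : ℕ → RGraph
cycleGraph m = record
  { W       = Fin m
  ; E       = Fin (suc m)
  ; ends    = λ i → (toV i , nxt i)
  ; nonroot = allFin m
  ; edges   = allFin (suc m)
  }

without : ∀ {m} → Fin (suc m) → Fin (suc m) → Bool
without e₁ e = not ⌊ e ≟F e₁ ⌋

without₂ : ∀ {m} → Fin (suc m) → Fin (suc m) → Fin (suc m) → Bool
without₂ e₁ e₂ e = not ⌊ e ≟F e₁ ⌋ ∧ not ⌊ e ≟F e₂ ⌋

-- Wedge  G ∧ H_{v_1} ∧ … ∧ H_{v_n}: the root of H_i is identified with
-- the non-root vertex  v i  of G; everything else is kept disjoint.

module _ (G : RGraph) {n : ℕ} (H : Fin n → RGraph) (v : Fin n → W G) where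
  private
    WW : Set
    WW = W G ⊎ Σ (Fin n) (λ i → W (H i))

    emb : (i : Fin n) → Maybe (W (H i)) → Maybe WW
    emb i nothing  = just (inj₁ (v i))
    emb i (just w) = just (inj₂ (i , w))

    endsW : E G ⊎ Σ (Fin n) (λ i → E (H i)) → Maybe WW × Maybe WW
    endsW (inj₁ e) = Maybe.map inj₁ (proj₁ (ends G e)) , Maybe.map inj₁ (proj₂ (ends G e))
    endsW (inj₂ (i , e)) = emb i (proj₁ (ends (H i) e)) , emb i (proj₂ (ends (H i) e))

  wedge : RGraph
  wedge = record
    { W       = WW
    ; E       = E G ⊎ Σ (Fin n) (λ i → E (H i))
    ; ends    = endsW
    ; nonroot = map inj₁ (nonroot G) ++ concatMap (λ i → map (λ w → inj₂ (i , w)) (nonroot (H i))) (allFin n)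
    ; edges   = map inj₁ (edges G) ++ concatMap (λ i → map (λ e → inj₂ (i , e)) (edges (H i))) (allFin n)
    }

  wedgeTree : (E G → Bool) → ((i : Fin n) → E (H i) → Bool) → E wedge → Bool
  wedgeTree T S = [ T , (λ p → S (proj₁ p) (proj₂ p)) ]

  wedgeW : {X : Set} → (E G → X) → ((i : Fin n) → E (H i) → X) → E wedge → X
  wedgeW f g = [ f , (λ p → g (proj₁ p) (proj₂ p)) ]

inList : ∀ {m} → Maybe (Fin m) → List (Maybe (Fin m)) → Bool
inList x []       = false
inList x (y ∷ ys) = ⌊ ≡-decM _≟F_ x y ⌋ Data.Bool.∨ inList x ys

-- A spanning tree of the wedge is a spanning tree T of the cycle together with spanning trees of the H_i,
-- since a path that leaves a cut vertex v_i cannot come back to it. Every vertex of H_i is reached through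
-- v_i, so the cost splits as cost(T) + Σ_i |H_i| d_T(v_i) + Σ_i cost(S_i). Hence the S_i are optimal on their
-- own, and it remains to minimise the potential Φ(k) = cost(C − e_k) + Σ_i |H_i| d_{C − e_k}(v_i) over the
-- spanning trees C − e_k of the cycle. Passing from C − e₁ to C − e₂ changes only the removed edge and the
-- depths of the vertices on the arc Q̃ between e₁ and e₂: in C − e₁ they are reached along P₂ and then Q̃⁺,
-- in C − e₂ along P₁ and then Q̃⁻. Summing these prefix lengths turns Φ(e₁) − Φ(e₂) into exactly the
-- expression assumed to be ≤ 0.

module Submission where

open import Defs
open import Data.Nat using (ℕ; suc) renaming (_≤_ to _≤ℕ_)
open import Data.Fin using (Fin)
open import Data.Bool using (Bool; if_then_else_)
open import Data.Maybe using (Maybe; just; nothing)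
open import Data.Product using (Σ; proj₁)
open import Data.List using (map; allFin; length; last)
open import Relation.Binary.PropositionalEquality using (_≡_; _≢_)

module Walks where

  open import Data.Bool using (Bool; true)
  open import Data.Empty using (⊥; ⊥-elim)
  open import Data.Fin using (suc)
  open import Data.Fin.Properties using () renaming (_≟_ to _≟F_)
  open import Data.Maybe using (Maybe; just; nothing; maybe′)
  open import Data.Product using (Σ; _×_; _,_; proj₁; proj₂)
  open import Data.Sum using (_⊎_; inj₁; inj₂)
  open import Data.List using (List; []; _∷_; _++_; map; mapMaybe; lookup; last)
  open import Data.List.Properties using (map-injective)
  open import Data.List.Membership.Propositional using (_∈_; _∉_)
  open import Data.List.Membership.Propositional.Properties using (∈-++⁺ˡ; ∈-++⁺ʳ)
  open import Data.List.Relation.Unary.Any using (here; there; index; any?)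
  open import Data.List.Relation.Unary.Any.Properties using (lookup-index)
  open import Data.List.Relation.Unary.All using (All; []; _∷_)
  open import Data.List.Relation.Unary.All.Properties using (¬Any⇒All¬)
  open import Data.List.Relation.Unary.Unique.Propositional using (Unique; []; _∷_)
  open import Data.List.Relation.Unary.Unique.Propositional.Properties
    using (Unique[x∷xs]⇒x∉xs) renaming (++⁺ to Unique-++⁺)
  open import Relation.Binary.PropositionalEquality
  open import Relation.Binary.Definitions using (DecidableEquality)
  open import Relation.Nullary using (Dec; yes; no)

  ∷-unique : ∀ {A : Set} {x : A} {xs} → x ∉ xs → Unique xs → Unique (x ∷ xs)
  ∷-unique {xs = xs} x∉xs u = ¬Any⇒All¬ xs x∉xs ∷ u

  unique-∷ʳ⁻ : ∀ {A : Set} (xs : List A) {y} → Unique (xs ++ y ∷ []) → Unique xs × y ∉ xs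
  unique-∷ʳ⁻ [] u = [] , λ ()
  unique-∷ʳ⁻ (x ∷ xs) (x∉ ∷ u) with unique-∷ʳ⁻ xs u
  ... | uxs , y∉xs =
    ∷-unique (λ x∈xs → Unique[x∷xs]⇒x∉xs (x∉ ∷ u) (∈-++⁺ˡ x∈xs)) uxs ,
    λ { (here refl) → Unique[x∷xs]⇒x∉xs (x∉ ∷ u) (∈-++⁺ʳ xs (here refl)) ; (there y∈xs) → y∉xs y∈xs }

  last-∷ʳ : ∀ {A : Set} (xs : List A) y → last (xs ++ y ∷ []) ≡ just y
  last-∷ʳ [] y = refl
  last-∷ʳ (x ∷ []) y = refl
  last-∷ʳ (x ∷ x′ ∷ xs) y = last-∷ʳ (x′ ∷ xs) y

  mapMaybe-just : ∀ {A B : Set} (h : A → B) (xs : List A) → mapMaybe (λ a → just (h a)) xs ≡ map h xs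
  mapMaybe-just h [] = refl
  mapMaybe-just h (x ∷ xs) = cong (h x ∷_) (mapMaybe-just h xs)

  index-unique : ∀ {A : Set} {x : A} {xs} → Unique xs → (p q : x ∈ xs) → index p ≡ index q
  index-unique _ (here refl) (here refl) = refl
  index-unique u (here refl) (there q) = ⊥-elim (Unique[x∷xs]⇒x∉xs u q)
  index-unique u (there p) (here refl) = ⊥-elim (Unique[x∷xs]⇒x∉xs u p)
  index-unique (_ ∷ u) (there p) (there q) = cong suc (index-unique u p q)

  decidableEquality-fromEnumeration : ∀ {A : Set} (xs : List A) → Unique xs → (∀ x → x ∈ xs) →
                                      DecidableEquality A
  decidableEquality-fromEnumeration xs u complete x y with index (complete x) ≟F index (complete y)
  ... | yes same = yes (trans (lookup-index (complete x))
                          (trans (cong (lookup xs) same) (sym (lookup-index (complete y)))))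
  ... | no differ = no λ { refl → differ (index-unique u (complete x) (complete y)) }

  infixr 5 _++ᵂ_
  _++ᵂ_ : ∀ {G T u x w} → Walk G T u x → Walk G T x w → Walk G T u w
  [] ++ᵂ q = q
  step e t j p ++ᵂ q = step e t j (p ++ᵂ q)

  UniquePaths : (G : RGraph) → (E G → Bool) → Set
  UniquePaths G T = (u w : Vx G) (p q : Walk G T u w) → IsPath G p → IsPath G q → edgesW G p ≡ edgesW G q

  module _ (G : RGraph) where

    Joins-sym : ∀ {e u x} → Joins G e u x → Joins G e x u
    Joins-sym (inj₁ p) = inj₂ p
    Joins-sym (inj₂ p) = inj₁ p

    initVerts : ∀ {T u w} → Walk G T u w → List (Vx G)
    initVerts [] = []
    initVerts (step {u} _ _ _ p) = u ∷ initVerts p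

    vertsW-initVerts : ∀ {T u w} (p : Walk G T u w) → vertsW G p ≡ initVerts p ++ w ∷ []
    vertsW-initVerts [] = refl
    vertsW-initVerts (step _ _ _ p) = cong (_ ∷_) (vertsW-initVerts p)

    source∈vertsW : ∀ {T u w} (p : Walk G T u w) → u ∈ vertsW G p
    source∈vertsW [] = here refl
    source∈vertsW (step _ _ _ _) = here refl

    target∈vertsW : ∀ {T u w} (p : Walk G T u w) → w ∈ vertsW G p
    target∈vertsW [] = here refl
    target∈vertsW (step _ _ _ p) = there (target∈vertsW p)

    All-vertsW-source : ∀ {P : Vx G → Set} {T u w} (p : Walk G T u w) → All P (vertsW G p) → P u
    All-vertsW-source [] (Pu ∷ _) = Pu
    All-vertsW-source (step _ _ _ _) (Pu ∷ _) = Pu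

    closedPath-edgesW : ∀ {T u} (p : Walk G T u u) → IsPath G p → edgesW G p ≡ []
    closedPath-edgesW [] _ = refl
    closedPath-edgesW (step _ _ _ p) u∉ = ⊥-elim (Unique[x∷xs]⇒x∉xs u∉ (target∈vertsW p))

    module _ {T T′ : E G → Bool} (T⊆T′ : ∀ e → T e ≡ true → T′ e ≡ true) where

      weaken : ∀ {u w} → Walk G T u w → Walk G T′ u w
      weaken [] = []
      weaken (step e t j p) = step e (T⊆T′ e t) j (weaken p)

      edgesW-weaken : ∀ {u w} (p : Walk G T u w) → edgesW G (weaken p) ≡ edgesW G p
      edgesW-weaken [] = refl
      edgesW-weaken (step e _ _ p) = cong (e ∷_) (edgesW-weaken p)

      vertsW-weaken : ∀ {u w} (p : Walk G T u w) → vertsW G (weaken p) ≡ vertsW G p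
      vertsW-weaken [] = refl
      vertsW-weaken (step _ _ _ p) = cong (_ ∷_) (vertsW-weaken p)

      weaken-isPath : ∀ {u w} (p : Walk G T u w) → IsPath G p → IsPath G (weaken p)
      weaken-isPath p = subst Unique (sym (vertsW-weaken p))

    edgesW-++ᵂ : ∀ {T u x w} (p : Walk G T u x) (q : Walk G T x w) →
                 edgesW G (p ++ᵂ q) ≡ edgesW G p ++ edgesW G q
    edgesW-++ᵂ [] q = refl
    edgesW-++ᵂ (step e _ _ p) q = cong (e ∷_) (edgesW-++ᵂ p q)

    vertsW-++ᵂ : ∀ {T u x w} (p : Walk G T u x) (q : Walk G T x w) →
                 vertsW G (p ++ᵂ q) ≡ initVerts p ++ vertsW G q
    vertsW-++ᵂ [] q = refl
    vertsW-++ᵂ (step _ _ _ p) q = cong (_ ∷_) (vertsW-++ᵂ p q)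

    ++ᵂ-isPath : ∀ {T u x w} (p : Walk G T u x) (q : Walk G T x w) → IsPath G p → IsPath G q →
                 (∀ {z} → z ∈ vertsW G p → z ∈ vertsW G q → z ≡ x) → IsPath G (p ++ᵂ q)
    ++ᵂ-isPath p q p-path q-path meetOnlyAtJunction with unique-∷ʳ⁻ (initVerts p) (subst Unique (vertsW-initVerts p) p-path)
    ... | init-unique , x∉init = subst Unique (sym (vertsW-++ᵂ p q)) (Unique-++⁺ init-unique q-path disjoint)
      where
      disjoint : ∀ {z} → z ∈ initVerts p × z ∈ vertsW G q → ⊥
      disjoint (z∈init , z∈q) =
        x∉init (subst (_∈ initVerts p)
                      (meetOnlyAtJunction (subst (_ ∈_) (sym (vertsW-initVerts p)) (∈-++⁺ˡ z∈init)) z∈q) z∈init)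

    reverseᵂ : ∀ {T u w} → Walk G T u w → Walk G T w u
    reverseᵂ [] = []
    reverseᵂ (step e t j p) = reverseᵂ p ++ᵂ step e t (Joins-sym j) []

    castPath : ∀ {T u u′ w w′} → u ≡ u′ → w ≡ w′ → Σ (Walk G T u w) (IsPath G) → Σ (Walk G T u′ w′) (IsPath G)
    castPath refl refl p = p

    edgesW-castPath : ∀ {T u u′ w w′} (u≡u′ : u ≡ u′) (w≡w′ : w ≡ w′) (p : Σ (Walk G T u w) (IsPath G)) →
                      edgesW G (proj₁ (castPath u≡u′ w≡w′ p)) ≡ edgesW G (proj₁ p)
    edgesW-castPath refl refl p = refl

    module LoopErasure (_≟V_ : DecidableEquality (Vx G)) where

      ∈? : (x : Vx G) (xs : List (Vx G)) → Dec (x ∈ xs)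
      ∈? x = any? (x ≟V_)

      dropUntil : ∀ {T x w} (p : Walk G T x w) → IsPath G p → ∀ {u} → u ∈ vertsW G p → Σ (Walk G T u w) (IsPath G)
      dropUntil [] u∉ (here refl) = [] , u∉
      dropUntil (step e t j p) u∉ (here refl) = step e t j p , u∉
      dropUntil (step _ _ _ p) (_ ∷ u∉) (there q) = dropUntil p u∉ q

      eraseLoops : ∀ {T u w} → Walk G T u w → Σ (Walk G T u w) (IsPath G)
      eraseLoops [] = [] , ([] ∷ [])
      eraseLoops {u = u} (step e t j p) with eraseLoops p
      ... | q , q-path with ∈? u (vertsW G q)
      ...   | yes u∈q = dropUntil q q-path u∈q
      ...   | no u∉q = step e t j q , ∷-unique u∉q q-path

  module WalkMap {G₁ G₂ : RGraph} {T₁ : E G₁ → Bool} {T₂ : E G₂ → Bool}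
                 (f : Vx G₁ → Vx G₂) (g : E G₁ → Maybe (E G₂))
                 (collapse : ∀ {e u x} → T₁ e ≡ true → Joins G₁ e u x → g e ≡ nothing → f u ≡ f x)
                 (preserve : ∀ {e e′ u x} → T₁ e ≡ true → Joins G₁ e u x → g e ≡ just e′ →
                             T₂ e′ ≡ true × Joins G₂ e′ (f u) (f x)) where

    castSource : ∀ {a b c} → a ≡ b → Walk G₂ T₂ b c → Walk G₂ T₂ a c
    castSource refl q = q

    edgesW-castSource : ∀ {a b c} (a≡b : a ≡ b) (q : Walk G₂ T₂ b c) → edgesW G₂ (castSource a≡b q) ≡ edgesW G₂ q
    edgesW-castSource refl q = refl

    vertsW-castSource : ∀ {a b c} (a≡b : a ≡ b) (q : Walk G₂ T₂ b c) → vertsW G₂ (castSource a≡b q) ≡ vertsW G₂ q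
    vertsW-castSource refl q = refl

    -- The case split on g e is taken through an explicit equation so that the lemmas below can repeat it.
    stepOver : ∀ {e u x c} → T₁ e ≡ true → Joins G₁ e u x → Walk G₂ T₂ (f x) c →
               (r : Maybe (E G₂)) → g e ≡ r → Walk G₂ T₂ (f u) c
    stepOver t j q nothing  ge = castSource (collapse t j ge) q
    stepOver t j q (just e′) ge = step e′ (proj₁ (preserve t j ge)) (proj₂ (preserve t j ge)) q

    mapWalk : ∀ {u w} → Walk G₁ T₁ u w → Walk G₂ T₂ (f u) (f w)
    mapWalk [] = []
    mapWalk (step e t j p) = stepOver t j (mapWalk p) (g e) refl

    edgesW-mapWalk : ∀ {u w} (p : Walk G₁ T₁ u w) → edgesW G₂ (mapWalk p) ≡ mapMaybe g (edgesW G₁ p)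
    edgesW-mapWalk [] = refl
    edgesW-mapWalk (step e t j p) = edgesW-stepOver t j (mapWalk p) (g e) refl (edgesW-mapWalk p)
      where
      edgesW-stepOver : ∀ {e u x c} (t : T₁ e ≡ true) (j : Joins G₁ e u x) (q : Walk G₂ T₂ (f x) c) r (ge : g e ≡ r) {es} →
                        edgesW G₂ q ≡ es → edgesW G₂ (stepOver t j q r ge) ≡ maybe′ _∷_ (λ xs → xs) r es
      edgesW-stepOver t j q nothing ge eq = trans (edgesW-castSource (collapse t j ge) q) eq
      edgesW-stepOver t j q (just e′) ge eq = cong (e′ ∷_) eq

    ∈-vertsW-mapWalk⁻ : ∀ {u w} (p : Walk G₁ T₁ u w) {y} → y ∈ vertsW G₂ (mapWalk p) →
                        Σ (Vx G₁) λ z → z ∈ vertsW G₁ p × f z ≡ y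
    ∈-vertsW-mapWalk⁻ [] (here refl) = _ , here refl , refl
    ∈-vertsW-mapWalk⁻ (step e t j p) y∈ = ∈-vertsW-stepOver (g e) refl y∈
      where
      later : ∀ {y} → y ∈ vertsW G₂ (mapWalk p) → Σ (Vx G₁) λ z → z ∈ vertsW G₁ (step e t j p) × f z ≡ y
      later y∈ with ∈-vertsW-mapWalk⁻ p y∈
      ... | z , z∈ , fz≡y = z , there z∈ , fz≡y
      ∈-vertsW-stepOver : ∀ r (ge : g e ≡ r) {y} → y ∈ vertsW G₂ (stepOver t j (mapWalk p) r ge) →
                          Σ (Vx G₁) λ z → z ∈ vertsW G₁ (step e t j p) × f z ≡ y
      ∈-vertsW-stepOver nothing ge y∈ = later (subst (_ ∈_) (vertsW-castSource (collapse t j ge) (mapWalk p)) y∈)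
      ∈-vertsW-stepOver (just _) ge (here refl) = _ , here refl , refl
      ∈-vertsW-stepOver (just _) ge (there y∈) = later y∈

    module _ (separated : ∀ {e u x w} (t : T₁ e ≡ true) (j : Joins G₁ e u x) (p : Walk G₁ T₁ x w) {e′} →
                          g e ≡ just e′ → IsPath G₁ (step e t j p) → ∀ {z} → z ∈ vertsW G₁ p → f z ≢ f u) where

      mapWalk-isPath : ∀ {u w} (p : Walk G₁ T₁ u w) → IsPath G₁ p → IsPath G₂ (mapWalk p)
      mapWalk-isPath [] _ = [] ∷ []
      mapWalk-isPath (step e t j p) p-path@(_ ∷ p-tail) = isPath-stepOver (g e) refl
        where
        rest : IsPath G₂ (mapWalk p)
        rest = mapWalk-isPath p p-tail
        isPath-stepOver : ∀ r (ge : g e ≡ r) → IsPath G₂ (stepOver t j (mapWalk p) r ge)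
        isPath-stepOver nothing ge = subst Unique (sym (vertsW-castSource (collapse t j ge) (mapWalk p))) rest
        isPath-stepOver (just _) ge = ∷-unique fu∉ rest
          where
          fu∉ : _ ∉ vertsW G₂ (mapWalk p)
          fu∉ y∈ with ∈-vertsW-mapWalk⁻ p y∈
          ... | z , z∈ , fz≡fu = separated t j p ge p-path z∈ fz≡fu

    mapWalk-isPath-injective : (∀ {x y} → f x ≡ f y → x ≡ y) →
                               ∀ {u w} (p : Walk G₁ T₁ u w) → IsPath G₁ p → IsPath G₂ (mapWalk p)
    mapWalk-isPath-injective f-inj = mapWalk-isPath λ _ _ _ _ u∉ z∈ fz≡fu →
      Unique[x∷xs]⇒x∉xs u∉ (subst (_∈ _) (f-inj fz≡fu) z∈)

  module Embedding {G₁ G₂ : RGraph} {T₁ : E G₁ → Bool} {T₂ : E G₂ → Bool}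
                   (ι : Vx G₁ → Vx G₂) (κ : E G₁ → E G₂)
                   (lift : ∀ {e u x} → T₁ e ≡ true → Joins G₁ e u x → T₂ (κ e) ≡ true × Joins G₂ (κ e) (ι u) (ι x)) where

    private
      edgeImage : E G₁ → Maybe (E G₂)
      edgeImage a = just (κ a)

      noCollapse : ∀ {e u x} → T₁ e ≡ true → Joins G₁ e u x → edgeImage e ≡ nothing → ι u ≡ ι x
      noCollapse _ _ ()

      preserve : ∀ {e e′ u x} → T₁ e ≡ true → Joins G₁ e u x → edgeImage e ≡ just e′ → T₂ e′ ≡ true × Joins G₂ e′ (ι u) (ι x)
      preserve t j refl = lift t j

    open WalkMap {G₁} {G₂} {T₁} {T₂} ι edgeImage noCollapse preserve public

    edgesW-embed : ∀ {u w} (p : Walk G₁ T₁ u w) → edgesW G₂ (mapWalk p) ≡ map κ (edgesW G₁ p)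
    edgesW-embed p = trans (edgesW-mapWalk p) (mapMaybe-just κ (edgesW G₁ p))

  Joins-functional : ∀ {G e u x x′} → Joins G e u x → Joins G e u x′ → x ≡ x′
  Joins-functional = functional
    where
    functional : ∀ {A : Set} {p : A × A} {u x x′} → (p ≡ (u , x) ⊎ p ≡ (x , u)) → (p ≡ (u , x′) ⊎ p ≡ (x′ , u)) → x ≡ x′
    functional (inj₁ refl) (inj₁ refl) = refl
    functional (inj₁ refl) (inj₂ refl) = refl
    functional (inj₂ refl) (inj₁ refl) = refl
    functional (inj₂ refl) (inj₂ refl) = refl

  isSpanningTree-retract :
    ∀ {G₁ G₂ : RGraph} {T₁ : E G₁ → Bool} {T₂ : E G₂ → Bool}
    (ι : Vx G₁ → Vx G₂) (κ : E G₁ → E G₂) →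
    (∀ {x y} → ι x ≡ ι y → x ≡ y) → (∀ {a b} → κ a ≡ κ b → a ≡ b) →
    (∀ {e u x} → T₁ e ≡ true → Joins G₁ e u x → T₂ (κ e) ≡ true × Joins G₂ (κ e) (ι u) (ι x)) →
    (π : Vx G₂ → Vx G₁) → (∀ x → π (ι x) ≡ x) →
    (∀ {u w} → Σ (Walk G₂ T₂ u w) (IsPath G₂) → Σ (Walk G₁ T₁ (π u) (π w)) (IsPath G₁)) →
    IsSpanningTree G₂ T₂ → IsSpanningTree G₁ T₁
  isSpanningTree-retract {G₁} {G₂} {T₁} {T₂} ι κ ι-inj κ-inj lift π π∘ι project (connected , unique) =
    (λ u w → castPath G₁ (π∘ι u) (π∘ι w) (project (connected (ι u) (ι w)))) ,
    λ u w p q p-path q-path → map-injective κ-inj (begin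
      map κ (edgesW G₁ p)           ≡⟨ edgesW-embed p ⟨
      edgesW G₂ (mapWalk p)         ≡⟨ unique _ _ _ _ (mapWalk-isPath-injective ι-inj p p-path) (mapWalk-isPath-injective ι-inj q q-path) ⟩
      edgesW G₂ (mapWalk q)         ≡⟨ edgesW-embed q ⟩
      map κ (edgesW G₁ q)           ∎)
    where
    open ≡-Reasoning
    open Embedding {G₁} {G₂} {T₁} {T₂} ι κ lift

module Wedge where

  open Walks
  open import Data.Nat using (ℕ)
  open import Data.Bool using (Bool; true)
  open import Data.Empty using (⊥; ⊥-elim)
  open import Data.Fin using (Fin)
  open import Data.Fin.Properties using () renaming (_≟_ to _≟F_)
  open import Data.Maybe using (Maybe; just; nothing)
  import Data.Maybe as Maybe
  open import Data.Maybe using (maybe′)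
  open import Data.Maybe.Properties using (just-injective) renaming (≡-dec to ≡-decMaybe; map-injective to Maybe-map-injective)
  open import Data.Sum using (_⊎_; inj₁; inj₂)
  open import Data.Sum.Properties using () renaming (≡-dec to ≡-dec⊎)
  open import Data.Product using (Σ; _×_; _,_; proj₁; proj₂)
  open import Data.Product.Properties using () renaming (≡-dec to ≡-decΣ)
  open import Data.List using ([]; _∷_; map; mapMaybe)
  open import Data.List.Properties using (∷-injectiveˡ)
  open import Data.List.Membership.Propositional using (_∈_; _∉_)
  open import Data.List.Relation.Unary.Any using (here; there)
  open import Data.List.Relation.Unary.All using (All; _∷_)
  import Data.List.Relation.Unary.All as All
  open import Data.List.Relation.Unary.Unique.Propositional using (_∷_)
  open import Data.List.Relation.Unary.Unique.Propositional.Properties using (Unique[x∷xs]⇒x∉xs)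
  open import Relation.Binary.PropositionalEquality
  open import Relation.Binary.Definitions using (DecidableEquality)
  open import Relation.Nullary using (yes; no)
  open import Function using (case_of_)

  module _ {A B : Set} (φ : A → B) where

    JoinsImage : A × A → B → B → Set
    JoinsImage p u x = (φ (proj₁ p) , φ (proj₂ p)) ≡ (u , x) ⊎ (φ (proj₁ p) , φ (proj₂ p)) ≡ (x , u)

    joinsImage : ∀ {p c c′} → (p ≡ (c , c′) ⊎ p ≡ (c′ , c)) → JoinsImage p (φ c) (φ c′)
    joinsImage (inj₁ refl) = inj₁ refl
    joinsImage (inj₂ refl) = inj₂ refl

    joinsImage⁻ : ∀ p {u x} → JoinsImage p u x →
                  Σ A λ c → Σ A λ c′ → u ≡ φ c × x ≡ φ c′ × (p ≡ (c , c′) ⊎ p ≡ (c′ , c))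
    joinsImage⁻ p (inj₁ refl) = proj₁ p , proj₂ p , refl , refl , inj₁ refl
    joinsImage⁻ p (inj₂ refl) = proj₂ p , proj₁ p , refl , refl , inj₂ refl

  module _ {n : ℕ} {F : Fin n → Set} where

    atIndex : (i : Fin n) → Σ (Fin n) F → Maybe (F i)
    atIndex i (j , x) with j ≟F i
    ... | yes refl = just x
    ... | no _ = nothing

    atIndex-self : ∀ i x → atIndex i (i , x) ≡ just x
    atIndex-self i x with i ≟F i
    ... | yes refl = refl
    ... | no i≢i = ⊥-elim (i≢i refl)

    atIndex-other : ∀ {i j} → j ≢ i → ∀ x → atIndex i (j , x) ≡ nothing
    atIndex-other {i} {j} j≢i x with j ≟F i
    ... | yes j≡i = ⊥-elim (j≢i j≡i)
    ... | no _ = refl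

    atIndex-just⁻ : ∀ i p {y} → atIndex i p ≡ just y → p ≡ (i , y)
    atIndex-just⁻ i (j , x) eq with j ≟F i
    atIndex-just⁻ i (j , x) refl | yes refl = refl
    atIndex-just⁻ i (j , x) () | no _

  module WedgeTrees (G : RGraph) {n : ℕ} (H : Fin n → RGraph) (v : Fin n → W G) where

    Gʷ : RGraph
    Gʷ = wedge G H v

    liftG : Vx G → Vx Gʷ
    liftG = Maybe.map inj₁

    liftH : (i : Fin n) → Vx (H i) → Vx Gʷ
    liftH i nothing = just (inj₁ (v i))
    liftH i (just w) = just (inj₂ (i , w))

    cutVertex : Fin n → Vx Gʷ
    cutVertex i = liftH i nothing

    -- Defs.wedge embeds the vertices of H i by a private copy of liftH.
    ends-inj₂ : ∀ i a → ends Gʷ (inj₂ (i , a)) ≡ (liftH i (proj₁ (ends (H i) a)) , liftH i (proj₂ (ends (H i) a)))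
    ends-inj₂ i a with ends (H i) a
    ... | nothing , nothing = refl
    ... | nothing , just _ = refl
    ... | just _ , nothing = refl
    ... | just _ , just _ = refl

    Joins-liftG : ∀ {a u x} → Joins G a u x → Joins Gʷ (inj₁ a) (liftG u) (liftG x)
    Joins-liftG = joinsImage liftG

    Joins-liftH : ∀ i {a u x} → Joins (H i) a u x → Joins Gʷ (inj₂ (i , a)) (liftH i u) (liftH i x)
    Joins-liftH i {a} j rewrite ends-inj₂ i a = joinsImage (liftH i) j

    Joins-liftG⁻ : ∀ {a u x} → Joins Gʷ (inj₁ a) u x →
                   Σ (Vx G) λ c → Σ (Vx G) λ c′ → u ≡ liftG c × x ≡ liftG c′ × Joins G a c c′
    Joins-liftG⁻ {a} = joinsImage⁻ liftG (ends G a)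

    Joins-liftH⁻ : ∀ {i a u x} → Joins Gʷ (inj₂ (i , a)) u x →
                   Σ (Vx (H i)) λ c → Σ (Vx (H i)) λ c′ → u ≡ liftH i c × x ≡ liftH i c′ × Joins (H i) a c c′
    Joins-liftH⁻ {i} {a} j rewrite ends-inj₂ i a = joinsImage⁻ (liftH i) (ends (H i) a) j

    liftG-injective : ∀ {x y} → liftG x ≡ liftG y → x ≡ y
    liftG-injective = Maybe-map-injective (λ { refl → refl })

    liftH-injective : ∀ i {x y} → liftH i x ≡ liftH i y → x ≡ y
    liftH-injective i {nothing} {nothing} _ = refl
    liftH-injective i {just _} {just _} refl = refl

    liftG≡liftH⁻ : ∀ {y} i {c} → liftG y ≡ liftH i c → c ≡ nothing
    liftG≡liftH⁻ i {nothing} _ = refl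
    liftG≡liftH⁻ {nothing} i {just _} ()
    liftG≡liftH⁻ {just _} i {just _} ()

    module _ (_≟G_ : DecidableEquality (W G)) (_≟H_ : ∀ i → DecidableEquality (W (H i))) where

      _≟ʷ_ : DecidableEquality (Vx Gʷ)
      _≟ʷ_ = ≡-decMaybe (≡-dec⊎ _≟G_ (≡-decΣ _≟F_ (_≟H_ _)))

    projG : Vx Gʷ → Vx G
    projG nothing = nothing
    projG (just (inj₁ x)) = just x
    projG (just (inj₂ (j , _))) = just (v j)

    projG-liftG : ∀ y → projG (liftG y) ≡ y
    projG-liftG nothing = refl
    projG-liftG (just _) = refl

    projG-liftH : ∀ j c → projG (liftH j c) ≡ just (v j)
    projG-liftH j nothing = refl
    projG-liftH j (just _) = refl

    projH : (i : Fin n) → Vx Gʷ → Vx (H i)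
    projH i (just (inj₂ p)) = atIndex i p
    projH i _ = nothing

    projH-liftG : ∀ i y → projH i (liftG y) ≡ nothing
    projH-liftG i nothing = refl
    projH-liftG i (just _) = refl

    projH-liftH : ∀ i c → projH i (liftH i c) ≡ c
    projH-liftH i nothing = refl
    projH-liftH i (just w) = atIndex-self i w

    projH-liftH-other : ∀ {i j} → j ≢ i → ∀ c → projH i (liftH j c) ≡ nothing
    projH-liftH-other j≢i nothing = refl
    projH-liftH-other j≢i (just w) = atIndex-other j≢i w

    projH-just⁻ : ∀ i y {w} → projH i y ≡ just w → y ≡ liftH i (just w)
    projH-just⁻ i (just (inj₂ p)) eq = cong (λ q → just (inj₂ q)) (atIndex-just⁻ i p eq)

    edgeG : E Gʷ → Maybe (E G)
    edgeG (inj₁ a) = just a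
    edgeG (inj₂ _) = nothing

    edgeH : (i : Fin n) → E Gʷ → Maybe (E (H i))
    edgeH i (inj₁ _) = nothing
    edgeH i (inj₂ p) = atIndex i p

    module _ (Tʷ : E Gʷ → Bool) where

      restrictG : E G → Bool
      restrictG a = Tʷ (inj₁ a)

      restrictH : (i : Fin n) → E (H i) → Bool
      restrictH i a = Tʷ (inj₂ (i , a))

      module LiftG = Embedding {G} {Gʷ} {restrictG} {Tʷ} liftG inj₁ (λ t j → t , Joins-liftG j)

      module LiftH (i : Fin n) = Embedding {H i} {Gʷ} {restrictH i} {Tʷ} (liftH i) (λ a → inj₂ (i , a)) (λ t j → t , Joins-liftH i j)

      liftGWalk : ∀ {u w} → Walk G restrictG u w → Walk Gʷ Tʷ (liftG u) (liftG w)
      liftGWalk = LiftG.mapWalk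

      liftHWalk : ∀ i {u w} → Walk (H i) (restrictH i) u w → Walk Gʷ Tʷ (liftH i u) (liftH i w)
      liftHWalk i = LiftH.mapWalk i

      edgesW-liftGWalk : ∀ {u w} (p : Walk G restrictG u w) → edgesW Gʷ (liftGWalk p) ≡ map inj₁ (edgesW G p)
      edgesW-liftGWalk = LiftG.edgesW-embed

      edgesW-liftHWalk : ∀ i {u w} (p : Walk (H i) (restrictH i) u w) →
                         edgesW Gʷ (liftHWalk i p) ≡ map (λ a → inj₂ (i , a)) (edgesW (H i) p)
      edgesW-liftHWalk i = LiftH.edgesW-embed i

      collapseG : ∀ {e u x} → Tʷ e ≡ true → Joins Gʷ e u x → edgeG e ≡ nothing → projG u ≡ projG x
      collapseG {inj₂ (j , a)} _ jn _ with Joins-liftH⁻ jn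
      ... | c , c′ , refl , refl , _ = trans (projG-liftH j c) (sym (projG-liftH j c′))

      preserveG : ∀ {e e′ u x} → Tʷ e ≡ true → Joins Gʷ e u x → edgeG e ≡ just e′ →
                  restrictG e′ ≡ true × Joins G e′ (projG u) (projG x)
      preserveG {inj₁ a} t jn refl with Joins-liftG⁻ jn
      ... | c , c′ , refl , refl , j = t , subst₂ (Joins G a) (sym (projG-liftG c)) (sym (projG-liftG c′)) j

      collapseH : ∀ i {e u x} → Tʷ e ≡ true → Joins Gʷ e u x → edgeH i e ≡ nothing → projH i u ≡ projH i x
      collapseH i {inj₁ a} _ jn _ with Joins-liftG⁻ jn
      ... | c , c′ , refl , refl , _ = trans (projH-liftG i c) (sym (projH-liftG i c′))
      collapseH i {inj₂ (j , a)} _ jn eq with Joins-liftH⁻ jn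
      ... | c , c′ , refl , refl , _ =
        trans (projH-liftH-other j≢i c) (sym (projH-liftH-other j≢i c′))
        where
        j≢i : j ≢ i
        j≢i refl = case trans (sym (atIndex-self i a)) eq of λ ()

      preserveH : ∀ i {e e′ u x} → Tʷ e ≡ true → Joins Gʷ e u x → edgeH i e ≡ just e′ →
                  restrictH i e′ ≡ true × Joins (H i) e′ (projH i u) (projH i x)
      preserveH i {inj₂ p} t jn eq with atIndex-just⁻ i p eq
      ... | refl with Joins-liftH⁻ jn
      ...   | c , c′ , refl , refl , j =
        t , subst₂ (Joins (H i) _) (sym (projH-liftH i c)) (sym (projH-liftH i c′)) j

      module ProjG = WalkMap {Gʷ} {G} {Tʷ} {restrictG} projG edgeG collapseG preserveG
      module ProjH (i : Fin n) = WalkMap {Gʷ} {H i} {Tʷ} {restrictH i} (projH i) (edgeH i) (collapseH i) (preserveH i)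

      OutsideH : Fin n → Vx Gʷ → Set
      OutsideH j y = ∀ w → y ≢ liftH j (just w)

      InsideH : Fin n → Vx Gʷ → Set
      InsideH i y = Σ (W (H i)) λ w → y ≡ liftH i (just w)

      liftG-outsideH : ∀ j y → OutsideH j (liftG y)
      liftG-outsideH j nothing w ()
      liftG-outsideH j (just _) w ()

      outsideH-step : ∀ j {e y x} → Joins Gʷ e y x → OutsideH j y → y ≢ cutVertex j → OutsideH j x
      outsideH-step j {inj₁ _} jn _ _ with Joins-liftG⁻ jn
      ... | _ , c′ , refl , refl , _ = liftG-outsideH j c′
      outsideH-step j {inj₂ _} jn y-out y≢cut w x≡ with Joins-liftH⁻ jn
      outsideH-step j {inj₂ _} jn y-out y≢cut w refl | nothing , just _ , refl , refl , _ = y≢cut refl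
      outsideH-step j {inj₂ _} jn y-out y≢cut w refl | just w″ , just _ , refl , refl , _ = y-out w″ refl

      outsideH-walk : ∀ j {y w} (p : Walk Gʷ Tʷ y w) → OutsideH j y → cutVertex j ∉ vertsW Gʷ p →
                      All (OutsideH j) (vertsW Gʷ p)
      outsideH-walk j [] y-out _ = y-out ∷ All.[]
      outsideH-walk j (step _ _ jn p) y-out cut∉ =
        y-out ∷ outsideH-walk j p (outsideH-step j jn y-out (λ y≡cut → cut∉ (here (sym y≡cut)))) (λ q → cut∉ (there q))

      insideH-step : ∀ i {e y x} → Joins Gʷ e y x → InsideH i y → x ≢ cutVertex i → InsideH i x
      insideH-step i {inj₁ _} jn (w , y≡) _ with Joins-liftG⁻ jn
      insideH-step i {inj₁ _} jn (w , ()) _ | nothing , _ , refl , refl , _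
      insideH-step i {inj₁ _} jn (w , ()) _ | just _ , _ , refl , refl , _
      insideH-step i {inj₂ _} jn (w , y≡) x≢cut with Joins-liftH⁻ jn
      insideH-step i {inj₂ _} jn (w , refl) x≢cut | just _ , nothing , refl , refl , _ = ⊥-elim (x≢cut refl)
      insideH-step i {inj₂ _} jn (w , refl) x≢cut | just _ , just w′ , refl , refl , _ = w′ , refl

      insideH-walk : ∀ i {y w} (p : Walk Gʷ Tʷ y w) → InsideH i y → cutVertex i ∉ vertsW Gʷ p →
                     All (InsideH i) (vertsW Gʷ p)
      insideH-walk i [] y-in _ = y-in ∷ All.[]
      insideH-walk i (step _ _ jn p) y-in cut∉ =
        y-in ∷ insideH-walk i p (insideH-step i jn y-in (λ x≡cut → cut∉ (there (subst (_∈ vertsW Gʷ p) x≡cut (source∈vertsW Gʷ p)))))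
                            (λ q → cut∉ (there q))

      edgeH-outsideH : ∀ i e {y x} → Joins Gʷ e y x → y ≢ x → OutsideH i y → OutsideH i x → edgeH i e ≡ nothing
      edgeH-outsideH i (inj₁ _) _ _ _ _ = refl
      edgeH-outsideH i (inj₂ (k , a)) jn y≢x y-out x-out with k ≟F i
      ... | no _ = refl
      ... | yes refl with Joins-liftH⁻ jn
      ...   | just w , _ , refl , refl , _ = ⊥-elim (y-out w refl)
      ...   | nothing , just w′ , refl , refl , _ = ⊥-elim (x-out w′ refl)
      ...   | nothing , nothing , refl , refl , _ = ⊥-elim (y≢x refl)

      edgesH-outsideH : ∀ i {y w} (p : Walk Gʷ Tʷ y w) → IsPath Gʷ p → All (OutsideH i) (vertsW Gʷ p) →
                        mapMaybe (edgeH i) (edgesW Gʷ p) ≡ []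
      edgesH-outsideH i [] _ _ = refl
      edgesH-outsideH i (step e _ jn p) p-path@(_ ∷ p-tail) (y-out ∷ rest)
        rewrite edgeH-outsideH i e jn (λ y≡x → Unique[x∷xs]⇒x∉xs p-path (subst (_∈ _) (sym y≡x) (source∈vertsW Gʷ p)))
                               y-out (All-vertsW-source Gʷ p rest)
        = edgesH-outsideH i p p-tail rest

      separatedG : ∀ {e u x w} (t : Tʷ e ≡ true) (j : Joins Gʷ e u x) (p : Walk Gʷ Tʷ x w) {e′} →
                   edgeG e ≡ just e′ → IsPath Gʷ (step e t j p) → ∀ {z} → z ∈ vertsW Gʷ p → projG z ≢ projG u
      separatedG {inj₁ _} _ jn p refl p-path {z} z∈p eq with Joins-liftG⁻ jn
      ... | y , y′ , refl , refl , _ = separate z (trans eq (projG-liftG y)) z∈p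
        where
        u∉p : liftG y ∉ vertsW Gʷ p
        u∉p = Unique[x∷xs]⇒x∉xs p-path
        separate : ∀ z → projG z ≡ y → z ∈ vertsW Gʷ p → ⊥
        separate nothing eq z∈p = u∉p (subst (λ q → liftG q ∈ vertsW Gʷ p) eq z∈p)
        separate (just (inj₁ _)) eq z∈p = u∉p (subst (λ q → liftG q ∈ vertsW Gʷ p) eq z∈p)
        separate (just (inj₂ (j , w))) eq z∈p =
          All.lookup (outsideH-walk j p (liftG-outsideH j y′) (subst (λ q → liftG q ∉ vertsW Gʷ p) (sym eq) u∉p)) z∈p w refl

      separatedH : ∀ i {e u x w} (t : Tʷ e ≡ true) (j : Joins Gʷ e u x) (p : Walk Gʷ Tʷ x w) {e′} →
                   edgeH i e ≡ just e′ → IsPath Gʷ (step e t j p) → ∀ {z} → z ∈ vertsW Gʷ p → projH i z ≢ projH i u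
      separatedH i {inj₂ p₀} _ jn p eh p-path {z} z∈p eq with atIndex-just⁻ i p₀ eh
      ... | refl with Joins-liftH⁻ jn
      ...   | just w , _ , refl , refl , _ =
        u∉p (subst (_∈ vertsW Gʷ p) (projH-just⁻ i z (trans eq (projH-liftH i (just w)))) z∈p)
        where
        u∉p = Unique[x∷xs]⇒x∉xs p-path
      ...   | nothing , nothing , refl , refl , _ = Unique[x∷xs]⇒x∉xs p-path (source∈vertsW Gʷ p)
      ...   | nothing , just w′ , refl , refl , _ with All.lookup (insideH-walk i p (w′ , refl) (Unique[x∷xs]⇒x∉xs p-path)) z∈p
      ...     | w″ , refl = case trans (sym (projH-liftH i (just w″))) eq of λ ()

      projGWalk-isPath : ∀ {u w} (p : Walk Gʷ Tʷ u w) → IsPath Gʷ p → IsPath G (ProjG.mapWalk p)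
      projGWalk-isPath = ProjG.mapWalk-isPath separatedG

      projHWalk-isPath : ∀ i {u w} (p : Walk Gʷ Tʷ u w) → IsPath Gʷ p → IsPath (H i) (ProjH.mapWalk i p)
      projHWalk-isPath i = ProjH.mapWalk-isPath i (separatedH i)

      module _ (st : IsSpanningTree Gʷ Tʷ) where

        restrictG-isSpanningTree : IsSpanningTree G restrictG
        restrictG-isSpanningTree =
          isSpanningTree-retract liftG inj₁ liftG-injective (λ { refl → refl }) (λ t j → t , Joins-liftG j)
            projG projG-liftG (λ (p , p-path) → ProjG.mapWalk p , projGWalk-isPath p p-path) st

        restrictH-isSpanningTree : ∀ i → IsSpanningTree (H i) (restrictH i)
        restrictH-isSpanningTree i =
          isSpanningTree-retract (liftH i) (λ a → inj₂ (i , a)) (liftH-injective i) (λ { refl → refl })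
            (λ t j → t , Joins-liftH i j)
            (projH i) (projH-liftH i) (λ (p , p-path) → ProjH.mapWalk i p , projHWalk-isPath i p p-path) st

      module _ (v-injective : ∀ i j → v i ≡ v j → i ≡ j)
               (G-unique : UniquePaths G restrictG) (H-unique : ∀ i → UniquePaths (H i) (restrictH i)) where

        liftH-sameIndex : ∀ {i k} c c′ → liftH i c ≡ liftH k c′ → i ≡ k
        liftH-sameIndex nothing nothing eq = v-injective _ _ (just-injective (cong projG eq))
        liftH-sameIndex (just _) (just _) refl = refl

        projectedEdgesG-unique : ∀ {u w} (p q : Walk Gʷ Tʷ u w) → IsPath Gʷ p → IsPath Gʷ q →
                                 mapMaybe edgeG (edgesW Gʷ p) ≡ mapMaybe edgeG (edgesW Gʷ q)
        projectedEdgesG-unique p q p-path q-path =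
          trans (sym (ProjG.edgesW-mapWalk p))
                (trans (G-unique _ _ _ _ (projGWalk-isPath p p-path) (projGWalk-isPath q q-path)) (ProjG.edgesW-mapWalk q))

        projectedEdgesH-unique : ∀ i {u w} (p q : Walk Gʷ Tʷ u w) → IsPath Gʷ p → IsPath Gʷ q →
                                 mapMaybe (edgeH i) (edgesW Gʷ p) ≡ mapMaybe (edgeH i) (edgesW Gʷ q)
        projectedEdgesH-unique i p q p-path q-path =
          trans (sym (ProjH.edgesW-mapWalk i p))
                (trans (H-unique i _ _ _ _ (projHWalk-isPath i p p-path) (projHWalk-isPath i q q-path)) (ProjH.edgesW-mapWalk i q))

        mapMaybe-edgeH-∷ : ∀ i a es → mapMaybe (edgeH i) (inj₂ (i , a) ∷ es) ≡ a ∷ mapMaybe (edgeH i) es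
        mapMaybe-edgeH-∷ i a es = cong (λ r → maybe′ _∷_ (λ xs → xs) r (mapMaybe (edgeH i) es)) (atIndex-self i a)

        -- Leaving the cut vertex of H i through G, a path never re-enters H i, so its projection to H i is empty.
        noMixedStart : ∀ {u x x′ w} i a a′ (t : Tʷ (inj₂ (i , a)) ≡ true) (j : Joins Gʷ (inj₂ (i , a)) u x) (p : Walk Gʷ Tʷ x w)
                       (t′ : Tʷ (inj₁ a′) ≡ true) (j′ : Joins Gʷ (inj₁ a′) u x′) (q : Walk Gʷ Tʷ x′ w) →
                       IsPath Gʷ (step _ t j p) → IsPath Gʷ (step _ t′ j′ q) → ⊥
        noMixedStart i a a′ t j p t′ j′ q p-path q-path@(_ ∷ q-tail) with Joins-liftH⁻ {i} {a} j | Joins-liftG⁻ {a′} j′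
        ... | c , _ , refl , refl , _ | y , y′ , u≡ , refl , _ with liftG≡liftH⁻ {y} i (sym u≡)
        ...   | refl = case trans (sym (mapMaybe-edgeH-∷ i a (edgesW Gʷ p)))
                         (trans (projectedEdgesH-unique i (step _ t j p) (step _ t′ j′ q) p-path q-path) q-avoids-H) of λ ()
          where
          q-avoids-H : mapMaybe (edgeH i) (edgesW Gʷ q) ≡ []
          q-avoids-H = edgesH-outsideH i q q-tail (outsideH-walk i q (liftG-outsideH i y′) (Unique[x∷xs]⇒x∉xs q-path))

        -- Two paths starting with edges of the same part agree after projection to that part.
        firstEdge-unique : ∀ {u x x′ w} e e′ (t : Tʷ e ≡ true) (j : Joins Gʷ e u x) (p : Walk Gʷ Tʷ x w)
                           (t′ : Tʷ e′ ≡ true) (j′ : Joins Gʷ e′ u x′) (q : Walk Gʷ Tʷ x′ w) →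
                           IsPath Gʷ (step e t j p) → IsPath Gʷ (step e′ t′ j′ q) → e ≡ e′
        firstEdge-unique (inj₁ a) (inj₁ a′) t j p t′ j′ q p-path q-path =
          cong inj₁ (∷-injectiveˡ (projectedEdgesG-unique (step _ t j p) (step _ t′ j′ q) p-path q-path))
        firstEdge-unique (inj₂ (i , a)) (inj₂ (k , a′)) t j p t′ j′ q p-path q-path
          with Joins-liftH⁻ {i} {a} j | Joins-liftH⁻ {k} {a′} j′
        ... | c , _ , u≡ , _ | c′ , _ , u≡′ , _ with liftH-sameIndex c c′ (trans (sym u≡) u≡′)
        ...   | refl = cong (λ b → inj₂ (i , b)) (∷-injectiveˡ (begin
                  a ∷ mapMaybe (edgeH i) (edgesW Gʷ p)   ≡⟨ mapMaybe-edgeH-∷ i a (edgesW Gʷ p) ⟨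
                  mapMaybe (edgeH i) (edgesW Gʷ (step _ t j p))
                    ≡⟨ projectedEdgesH-unique i (step _ t j p) (step _ t′ j′ q) p-path q-path ⟩
                  mapMaybe (edgeH i) (edgesW Gʷ (step _ t′ j′ q))   ≡⟨ mapMaybe-edgeH-∷ i a′ (edgesW Gʷ q) ⟩
                  a′ ∷ mapMaybe (edgeH i) (edgesW Gʷ q)   ∎))
          where open ≡-Reasoning
        firstEdge-unique (inj₂ (i , a)) (inj₁ a′) t j p t′ j′ q p-path q-path =
          ⊥-elim (noMixedStart i a a′ t j p t′ j′ q p-path q-path)
        firstEdge-unique (inj₁ a) (inj₂ (i , a′)) t j p t′ j′ q p-path q-path =
          ⊥-elim (noMixedStart i a′ a t′ j′ q t j p q-path p-path)

        wedge-uniquePaths : UniquePaths Gʷ Tʷ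
        wedge-uniquePaths u w [] [] _ _ = refl
        wedge-uniquePaths u w [] q@(step _ _ _ _) _ q-path = sym (closedPath-edgesW Gʷ q q-path)
        wedge-uniquePaths u w p@(step _ _ _ _) [] p-path _ = closedPath-edgesW Gʷ p p-path
        wedge-uniquePaths u w (step e t j p) (step e′ t′ j′ q) p-path@(_ ∷ p-tail) q-path@(_ ∷ q-tail)
          with firstEdge-unique e e′ t j p t′ j′ q p-path q-path
        ... | refl with Joins-functional {Gʷ} {e} j j′
        ...   | refl = cong (e ∷_) (wedge-uniquePaths _ w p q p-tail q-tail)

      module _ (stG : IsSpanningTree G restrictG) (stH : ∀ i → IsSpanningTree (H i) (restrictH i)) where

        rootPathG : (x : Vx G) → Walk G restrictG nothing x
        rootPathG x = proj₁ (proj₁ stG nothing x)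

        rootPathH : ∀ i (y : Vx (H i)) → Walk (H i) (restrictH i) nothing y
        rootPathH i y = proj₁ (proj₁ (stH i) nothing y)

        liftedRootPathG : ∀ x → Walk Gʷ Tʷ nothing (liftG x)
        liftedRootPathG x = liftGWalk (rootPathG x)

        liftedRootPathG-isPath : ∀ x → IsPath Gʷ (liftedRootPathG x)
        liftedRootPathG-isPath x = LiftG.mapWalk-isPath-injective liftG-injective (rootPathG x) (proj₂ (proj₁ stG nothing x))

        liftedRootPathH : ∀ i y → Walk Gʷ Tʷ nothing (liftH i (just y))
        liftedRootPathH i y = liftedRootPathG (just (v i)) ++ᵂ liftHWalk i (rootPathH i (just y))

        liftedRootPathH-isPath : ∀ i y → IsPath Gʷ (liftedRootPathH i y)
        liftedRootPathH-isPath i y =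
          ++ᵂ-isPath Gʷ (liftedRootPathG (just (v i))) (liftHWalk i (rootPathH i (just y)))
            (liftedRootPathG-isPath (just (v i)))
            (LiftH.mapWalk-isPath-injective i (liftH-injective i) (rootPathH i (just y)) (proj₂ (proj₁ (stH i) nothing (just y))))
            meetAtCutVertex
          where
          meetAtCutVertex : ∀ {z} → z ∈ vertsW Gʷ (liftedRootPathG (just (v i))) →
                            z ∈ vertsW Gʷ (liftHWalk i (rootPathH i (just y))) → z ≡ cutVertex i
          meetAtCutVertex z∈G z∈H with LiftG.∈-vertsW-mapWalk⁻ (rootPathG (just (v i))) z∈G
                                     | LiftH.∈-vertsW-mapWalk⁻ i (rootPathH i (just y)) z∈H
          ... | y₀ , _ , refl | c , _ , z≡ with liftG≡liftH⁻ {y₀} i (sym z≡)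
          ...   | refl = sym z≡

        rootPath : (z : Vx Gʷ) → Walk Gʷ Tʷ nothing z
        rootPath nothing = []
        rootPath (just (inj₁ x)) = liftedRootPathG (just x)
        rootPath (just (inj₂ (i , y))) = liftedRootPathH i y

        wedge-isSpanningTree : (∀ i j → v i ≡ v j → i ≡ j) →
                               DecidableEquality (W G) → (∀ i → DecidableEquality (W (H i))) →
                               IsSpanningTree Gʷ Tʷ
        wedge-isSpanningTree v-injective _≟G_ _≟H_ =
          (λ u w → eraseLoops (reverseᵂ Gʷ (rootPath u) ++ᵂ rootPath w)) ,
          wedge-uniquePaths v-injective (proj₂ stG) (λ i → proj₂ (stH i))
          where open LoopErasure Gʷ (_≟ʷ_ _≟G_ _≟H_)

module Sums where

  open import Level using (0ℓ)
  open import Data.Nat using (zero; suc)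
  open import Data.List using (List; []; _∷_; _++_; map; length; concatMap)
  open import Data.List.Properties using (map-++)
  open import Data.List.Membership.Propositional using (_∈_)
  open import Data.List.Relation.Unary.Any using (here; there)
  open import Algebra.Bundles using (CommutativeMonoid; AbelianGroup)
  import Algebra.Properties.AbelianGroup as AbelianGroupProperties
  open import Algebra.Structures using (IsAbelianGroup)
  open import Relation.Binary.Structures using (IsTotalOrder)
  import Relation.Binary.Reasoning.Setoid as SetoidReasoning
  open import Relation.Binary.PropositionalEquality using (_≡_; cong)

  private
    variable
      X Y : Set

  module OrderedAbelianGroupProperties (A : OrderedAbelianGroup) where

    open OrderedAbelianGroup A public
    open IsAbelianGroup isAbelianGroup public
      using (setoid; assoc; comm; identityˡ; identityʳ; inverseʳ; ⁻¹-cong; isCommutativeMonoid)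
      renaming (refl to ≈-refl; sym to ≈-sym; trans to ≈-trans; reflexive to ≈-reflexive;
                ∙-cong to +-cong; ∙-congˡ to +-congˡ; ∙-congʳ to +-congʳ)
    open IsTotalOrder isTotalOrder public
      using (≤-respˡ-≈; ≤-respʳ-≈) renaming (reflexive to ≤-reflexive; trans to ≤-trans)
    open SetoidReasoning setoid public

    +-commutativeMonoid : CommutativeMonoid 0ℓ 0ℓ
    +-commutativeMonoid = record { isCommutativeMonoid = isCommutativeMonoid }

    +-abelianGroup : AbelianGroup 0ℓ 0ℓ
    +-abelianGroup = record { isAbelianGroup = isAbelianGroup }

    open AbelianGroupProperties +-abelianGroup public using (⁻¹-∙-comm; ε⁻¹≈ε)

    +-monoʳ-≤ : ∀ {x y} z → x ≤ y → z + x ≤ z + y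
    +-monoʳ-≤ {x} {y} z x≤y = ≤-trans (≤-reflexive (comm z x)) (≤-trans (+-monoˡ-≤ z x≤y) (≤-reflexive (comm y z)))

    +-mono-≤ : ∀ {x y u w} → x ≤ y → u ≤ w → x + u ≤ y + w
    +-mono-≤ {y = y} {u = u} x≤y u≤w = ≤-trans (+-monoˡ-≤ u x≤y) (+-monoʳ-≤ y u≤w)

    x≈y+[x-y] : ∀ x y → x ≈ y + (x - y)
    x≈y+[x-y] x y = begin
      x                ≈⟨ identityˡ x ⟨
      0# + x           ≈⟨ +-congʳ (inverseʳ y) ⟨
      (y - y) + x      ≈⟨ assoc y (- y) x ⟩
      y + (- y + x)    ≈⟨ +-congˡ (comm (- y) x) ⟩
      y + (x - y)      ∎

    +-interchange : ∀ a b c d → (a + b) + (c + d) ≈ (a + c) + (b + d)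
    +-interchange a b c d = begin
      (a + b) + (c + d) ≈⟨ assoc a b (c + d) ⟩
      a + (b + (c + d)) ≈⟨ +-congˡ (assoc b c d) ⟨
      a + ((b + c) + d) ≈⟨ +-congˡ (+-congʳ (comm b c)) ⟩
      a + ((c + b) + d) ≈⟨ +-congˡ (assoc c b d) ⟩
      a + (c + (b + d)) ≈⟨ assoc a c (b + d) ⟨
      (a + c) + (b + d) ∎

    ·-cong : ∀ n {x y} → x ≈ y → n · x ≈ n · y
    ·-cong zero _ = ≈-refl
    ·-cong (suc n) x≈y = +-cong x≈y (·-cong n x≈y)

    ·-distrib-+ : ∀ n x y → n · (x + y) ≈ n · x + n · y
    ·-distrib-+ zero x y = ≈-sym (identityˡ _)
    ·-distrib-+ (suc n) x y = ≈-trans (+-congˡ (·-distrib-+ n x y)) (+-interchange x y (n · x) (n · y))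

    ·-neg : ∀ n x → n · (- x) ≈ - (n · x)
    ·-neg zero x = ≈-sym ε⁻¹≈ε
    ·-neg (suc n) x = ≈-trans (+-congˡ (·-neg n x)) (⁻¹-∙-comm x (n · x))

    sumA-++ : ∀ xs ys → sumA (xs ++ ys) ≈ sumA xs + sumA ys
    sumA-++ [] ys = ≈-sym (identityˡ _)
    sumA-++ (x ∷ xs) ys = ≈-trans (+-congˡ (sumA-++ xs ys)) (≈-sym (assoc _ _ _))


    sumA-map-++ : (f : X → Carrier) (xs ys : List X) → sumA (map f (xs ++ ys)) ≈ sumA (map f xs) + sumA (map f ys)
    sumA-map-++ f xs ys = ≈-trans (≈-reflexive (cong sumA (map-++ f xs ys))) (sumA-++ (map f xs) (map f ys))

    sumA-cong : ∀ {f g : X → Carrier} (xs : List X) → (∀ x → x ∈ xs → f x ≈ g x) → sumA (map f xs) ≈ sumA (map g xs)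
    sumA-cong [] _ = ≈-refl
    sumA-cong (x ∷ xs) f≈g = +-cong (f≈g x (here _≡_.refl)) (sumA-cong xs (λ y y∈ → f≈g y (there y∈)))

    sumA-+ : (f g : X → Carrier) (xs : List X) → sumA (map (λ x → f x + g x) xs) ≈ sumA (map f xs) + sumA (map g xs)
    sumA-+ f g [] = ≈-sym (identityˡ _)
    sumA-+ f g (x ∷ xs) = ≈-trans (+-congˡ (sumA-+ f g xs)) (+-interchange _ _ _ _)

    sumA-const : (c : Carrier) (xs : List X) → sumA (map (λ _ → c) xs) ≈ length xs · c
    sumA-const c [] = ≈-refl
    sumA-const c (x ∷ xs) = +-congˡ (sumA-const c xs)

    sumA-mono : (f g : X → Carrier) (xs : List X) → (∀ x → f x ≤ g x) → sumA (map f xs) ≤ sumA (map g xs)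
    sumA-mono f g [] _ = ≤-reflexive ≈-refl
    sumA-mono f g (x ∷ xs) f≤g = +-mono-≤ (f≤g x) (sumA-mono f g xs f≤g)

    sumA-map : (F : Y → Carrier) (h : X → Y) (xs : List X) → sumA (map F (map h xs)) ≈ sumA (map (λ x → F (h x)) xs)
    sumA-map F h [] = ≈-refl
    sumA-map F h (x ∷ xs) = +-congˡ (sumA-map F h xs)

    sumA-concatMap : (F : Y → Carrier) (h : X → List Y) (xs : List X) →
                     sumA (map F (concatMap h xs)) ≈ sumA (map (λ x → sumA (map F (h x))) xs)
    sumA-concatMap F h [] = ≈-refl
    sumA-concatMap F h (x ∷ xs) = ≈-trans (sumA-map-++ F (h x) (concatMap h xs)) (+-congˡ (sumA-concatMap F h xs))

    Lw-++ : (γ : X → Carrier) (xs ys : List X) → Lw A γ (xs ++ ys) ≈ Lw A γ xs + Lw A γ ys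
    Lw-++ γ = sumA-map-++ γ

module WedgeCost where

  open Walks
  open Wedge
  open Sums
  open import Data.Nat using (ℕ)
  open import Data.Bool using (Bool; if_then_else_)
  open import Data.Fin using (Fin)
  open import Data.Maybe using (just; nothing)
  open import Data.Sum using (inj₁; inj₂)
  open import Data.Product using (_,_; proj₁; proj₂)
  open import Data.List using (List; _++_; map; length; concatMap; allFin)
  open import Relation.Binary.PropositionalEquality using (cong)

  module TreeCost (A : OrderedAbelianGroup) where

    open OrderedAbelianGroupProperties A

    depth : (G : RGraph) (γ : E G → Carrier) {T : E G → Bool} → IsSpanningTree G T → Vx G → Carrier
    depth G γ st x = Lw A γ (edgesW G (proj₁ (proj₁ st nothing x)))

    depth-path : ∀ {G γ T} (st : IsSpanningTree G T) {x} (p : Walk G T nothing x) → IsPath G p →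
                 depth G γ st x ≈ Lw A γ (edgesW G p)
    depth-path {γ = γ} st p p-path =
      ≈-reflexive (cong (Lw A γ) (proj₂ st _ _ _ p (proj₂ (proj₁ st nothing _)) p-path))

    depth-root : ∀ {G γ T} (st : IsSpanningTree G T) → depth G γ st nothing ≈ 0#
    depth-root {G} {γ} st = ≈-reflexive (cong (Lw A γ) (closedPath-edgesW G _ (proj₂ (proj₁ st nothing nothing))))

    edgeCost : (G : RGraph) → (E G → Carrier) → (E G → Bool) → Carrier
    edgeCost G τ T = sumA (map (λ e → if T e then τ e else 0#) (edges G))

    totalDepth : (G : RGraph) (γ : E G → Carrier) {T : E G → Bool} → IsSpanningTree G T → Carrier
    totalDepth G γ st = sumA (map (λ w → depth G γ st (just w)) (nonroot G))

    cost≈edgeCost+totalDepth : ∀ G γ τ {T} (st : IsSpanningTree G T) →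
                               cost A G γ τ T st ≈ edgeCost G τ T + totalDepth G γ st
    cost≈edgeCost+totalDepth G γ τ st =
      +-congˡ (≈-trans (+-cong (depth-root st) (sumA-map (depth G γ st) just (nonroot G))) (identityˡ _))

  module WedgeCostDecomposition (A : OrderedAbelianGroup) (G : RGraph) {n : ℕ} (H : Fin n → RGraph) (v : Fin n → W G)
                                (γ τ : E G → OrderedAbelianGroup.Carrier A)
                                (γH τH : ∀ i → E (H i) → OrderedAbelianGroup.Carrier A) where

    open OrderedAbelianGroupProperties A
    open TreeCost A
    open WedgeTrees G H v

    γʷ τʷ : E Gʷ → Carrier
    γʷ = wedgeW G H v γ γH
    τʷ = wedgeW G H v τ τH

    module _ (Tʷ : E Gʷ → Bool) (st : IsSpanningTree Gʷ Tʷ)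
             (stG : IsSpanningTree G (restrictG Tʷ)) (stH : ∀ i → IsSpanningTree (H i) (restrictH Tʷ i)) where

      depth-liftG : ∀ x → depth Gʷ γʷ st (liftG (just x)) ≈ depth G γ stG (just x)
      depth-liftG x = begin
        depth Gʷ γʷ st (liftG (just x))
          ≈⟨ depth-path st (liftedRootPathG Tʷ stG stH (just x)) (liftedRootPathG-isPath Tʷ stG stH (just x)) ⟩
        Lw A γʷ (edgesW Gʷ (liftGWalk Tʷ (rootPathG Tʷ stG stH (just x))))
          ≈⟨ ≈-reflexive (cong (Lw A γʷ) (edgesW-liftGWalk Tʷ (rootPathG Tʷ stG stH (just x)))) ⟩
        Lw A γʷ (map inj₁ (edgesW G (rootPathG Tʷ stG stH (just x))))
          ≈⟨ sumA-map γʷ inj₁ (edgesW G (rootPathG Tʷ stG stH (just x))) ⟩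
        depth G γ stG (just x) ∎

      depth-liftH : ∀ i y → depth Gʷ γʷ st (liftH i (just y)) ≈ depth G γ stG (just (v i)) + depth (H i) (γH i) (stH i) (just y)
      depth-liftH i y = begin
        depth Gʷ γʷ st (liftH i (just y))
          ≈⟨ depth-path st (liftedRootPathH Tʷ stG stH i y) (liftedRootPathH-isPath Tʷ stG stH i y) ⟩
        Lw A γʷ (edgesW Gʷ (liftGWalk Tʷ pG ++ᵂ liftHWalk Tʷ i pH))
          ≈⟨ ≈-reflexive (cong (Lw A γʷ) (edgesW-++ᵂ Gʷ (liftGWalk Tʷ pG) (liftHWalk Tʷ i pH))) ⟩
        Lw A γʷ (edgesW Gʷ (liftGWalk Tʷ pG) ++ edgesW Gʷ (liftHWalk Tʷ i pH))
          ≈⟨ Lw-++ γʷ (edgesW Gʷ (liftGWalk Tʷ pG)) _ ⟩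
        Lw A γʷ (edgesW Gʷ (liftGWalk Tʷ pG)) + Lw A γʷ (edgesW Gʷ (liftHWalk Tʷ i pH))
          ≈⟨ +-cong (≈-reflexive (cong (Lw A γʷ) (edgesW-liftGWalk Tʷ pG)))
                    (≈-reflexive (cong (Lw A γʷ) (edgesW-liftHWalk Tʷ i pH))) ⟩
        Lw A γʷ (map inj₁ (edgesW G pG)) + Lw A γʷ (map (λ a → inj₂ (i , a)) (edgesW (H i) pH))
          ≈⟨ +-cong (sumA-map γʷ inj₁ (edgesW G pG)) (sumA-map γʷ (λ a → inj₂ (i , a)) (edgesW (H i) pH)) ⟩
        depth G γ stG (just (v i)) + depth (H i) (γH i) (stH i) (just y) ∎
        where
        pG = rootPathG Tʷ stG stH (just (v i))
        pH = rootPathH Tʷ stG stH i (just y)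

      edgeCost-wedge : edgeCost Gʷ τʷ Tʷ ≈ edgeCost G τ (restrictG Tʷ) + sumA (map (λ i → edgeCost (H i) (τH i) (restrictH Tʷ i)) (allFin n))
      edgeCost-wedge = begin
        sumA (map τT (map inj₁ (edges G) ++ concatMap edgesH (allFin n)))
          ≈⟨ sumA-map-++ τT (map inj₁ (edges G)) (concatMap edgesH (allFin n)) ⟩
        sumA (map τT (map inj₁ (edges G))) + sumA (map τT (concatMap edgesH (allFin n)))
          ≈⟨ +-cong (sumA-map τT inj₁ (edges G)) (sumA-concatMap τT edgesH (allFin n)) ⟩
        edgeCost G τ (restrictG Tʷ) + sumA (map (λ i → sumA (map τT (edgesH i))) (allFin n))
          ≈⟨ +-congˡ (sumA-cong (allFin n) (λ i _ → sumA-map τT (λ e → inj₂ (i , e)) (edges (H i)))) ⟩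
        edgeCost G τ (restrictG Tʷ) + sumA (map (λ i → edgeCost (H i) (τH i) (restrictH Tʷ i)) (allFin n)) ∎
        where
        τT : E Gʷ → Carrier
        τT e = if Tʷ e then τʷ e else 0#
        edgesH : Fin n → List (E Gʷ)
        edgesH i = map (λ e → inj₂ (i , e)) (edges (H i))

      hangingDepth : Fin n → Carrier
      hangingDepth i = length (nonroot (H i)) · depth G γ stG (just (v i))

      totalDepth-wedge : totalDepth Gʷ γʷ st ≈
                         totalDepth G γ stG + (sumA (map hangingDepth (allFin n)) + sumA (map (λ i → totalDepth (H i) (γH i) (stH i)) (allFin n)))
      totalDepth-wedge = begin
        sumA (map D (map inj₁ (nonroot G) ++ concatMap verticesH (allFin n)))
          ≈⟨ sumA-map-++ D (map inj₁ (nonroot G)) (concatMap verticesH (allFin n)) ⟩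
        sumA (map D (map inj₁ (nonroot G))) + sumA (map D (concatMap verticesH (allFin n)))
          ≈⟨ +-cong (≈-trans (sumA-map D inj₁ (nonroot G)) (sumA-cong (nonroot G) (λ x _ → depth-liftG x)))
                    (sumA-concatMap D verticesH (allFin n)) ⟩
        totalDepth G γ stG + sumA (map (λ i → sumA (map D (verticesH i))) (allFin n))
          ≈⟨ +-congˡ (sumA-cong (allFin n) (λ i _ → perComponent i)) ⟩
        totalDepth G γ stG + sumA (map (λ i → hangingDepth i + totalDepth (H i) (γH i) (stH i)) (allFin n))
          ≈⟨ +-congˡ (sumA-+ hangingDepth (λ i → totalDepth (H i) (γH i) (stH i)) (allFin n)) ⟩
        totalDepth G γ stG + (sumA (map hangingDepth (allFin n)) + sumA (map (λ i → totalDepth (H i) (γH i) (stH i)) (allFin n))) ∎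
        where
        D : W Gʷ → Carrier
        D z = depth Gʷ γʷ st (just z)
        verticesH : Fin n → List (W Gʷ)
        verticesH i = map (λ w → inj₂ (i , w)) (nonroot (H i))
        perComponent : ∀ i → sumA (map D (verticesH i)) ≈ hangingDepth i + totalDepth (H i) (γH i) (stH i)
        perComponent i = begin
          sumA (map D (verticesH i))
            ≈⟨ sumA-map D (λ w → inj₂ (i , w)) (nonroot (H i)) ⟩
          sumA (map (λ w → D (inj₂ (i , w))) (nonroot (H i)))
            ≈⟨ sumA-cong (nonroot (H i)) (λ w _ → depth-liftH i w) ⟩
          sumA (map (λ w → depth G γ stG (just (v i)) + depth (H i) (γH i) (stH i) (just w)) (nonroot (H i)))
            ≈⟨ sumA-+ (λ _ → depth G γ stG (just (v i))) (λ w → depth (H i) (γH i) (stH i) (just w)) (nonroot (H i)) ⟩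
          sumA (map (λ _ → depth G γ stG (just (v i))) (nonroot (H i))) + totalDepth (H i) (γH i) (stH i)
            ≈⟨ +-congʳ (sumA-const (depth G γ stG (just (v i))) (nonroot (H i))) ⟩
          hangingDepth i + totalDepth (H i) (γH i) (stH i) ∎

      wedge-cost : cost A Gʷ γʷ τʷ Tʷ st ≈
                   cost A G γ τ (restrictG Tʷ) stG +
                   (sumA (map hangingDepth (allFin n)) + sumA (map (λ i → cost A (H i) (γH i) (τH i) (restrictH Tʷ i) (stH i)) (allFin n)))
      wedge-cost = begin
        cost A Gʷ γʷ τʷ Tʷ st
          ≈⟨ cost≈edgeCost+totalDepth Gʷ γʷ τʷ st ⟩
        edgeCost Gʷ τʷ Tʷ + totalDepth Gʷ γʷ st
          ≈⟨ +-cong edgeCost-wedge totalDepth-wedge ⟩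
        (eG + sumA (map eH (allFin n))) + (dG + (sumA (map hangingDepth (allFin n)) + sumA (map dH (allFin n))))
          ≈⟨ regroup eG (sumA (map eH (allFin n))) dG (sumA (map hangingDepth (allFin n))) (sumA (map dH (allFin n))) ⟩
        (eG + dG) + (sumA (map hangingDepth (allFin n)) + (sumA (map eH (allFin n)) + sumA (map dH (allFin n))))
          ≈⟨ +-cong (≈-sym (cost≈edgeCost+totalDepth G γ τ stG))
                    (+-congˡ (≈-trans (≈-sym (sumA-+ eH dH (allFin n)))
                                      (sumA-cong (allFin n) (λ i _ → ≈-sym (cost≈edgeCost+totalDepth (H i) (γH i) (τH i) (stH i)))))) ⟩
        cost A G γ τ (restrictG Tʷ) stG +
        (sumA (map hangingDepth (allFin n)) + sumA (map (λ i → cost A (H i) (γH i) (τH i) (restrictH Tʷ i) (stH i)) (allFin n))) ∎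
        where
        eG = edgeCost G τ (restrictG Tʷ)
        dG = totalDepth G γ stG
        eH : Fin n → Carrier
        eH i = edgeCost (H i) (τH i) (restrictH Tʷ i)
        dH : Fin n → Carrier
        dH i = totalDepth (H i) (γH i) (stH i)
        regroup : ∀ a b c d e → (a + b) + (c + (d + e)) ≈ (a + c) + (d + (b + e))
        regroup = solve 5 (λ a b c d e → (a ⊕ b) ⊕ (c ⊕ (d ⊕ e)) ⊜ (a ⊕ c) ⊕ (d ⊕ (b ⊕ e))) ≈-refl
          where open import Algebra.Solver.CommutativeMonoid +-commutativeMonoid using (solve; _⊜_; _⊕_)

module Cycle where

  open Walks
  open import Data.Nat using (ℕ; zero; suc; _+_; _∸_; _≤_; _<_; z≤n; s≤s; _≤?_)
  open import Data.Nat.Properties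
  open import Data.Fin using (Fin; toℕ) renaming (zero to fzero; suc to fsuc)
  open import Data.Fin.Properties using (toℕ≤pred[n]; toℕ-injective; any?) renaming (_≟_ to _≟F_)
  open import Data.Bool using (Bool; true; false; _∧_; if_then_else_) renaming (_≟_ to _≟B_)
  open import Data.Bool.Properties using (∧-zeroʳ)
  open import Data.Maybe using (Maybe; just; nothing)
  import Data.Maybe as Maybe
  open import Data.Product using (Σ; _×_; _,_; proj₁; proj₂)
  open import Data.Sum using (_⊎_; inj₁; inj₂)
  open import Data.Empty using (⊥; ⊥-elim)
  open import Data.List using (List; []; _∷_; _++_; map; allFin; length; last; tabulate)
  open import Data.List.Membership.Propositional using (_∈_; _∉_)
  open import Data.List.Membership.Propositional.Properties using (∈-map⁻; ∈-map⁺)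
  open import Data.List.Relation.Unary.Any using (here; there)
  open import Data.List.Relation.Unary.Unique.Propositional using (Unique; [])
  open import Data.List.Relation.Unary.Unique.Propositional.Properties using () renaming (map⁻ to Unique-map⁻)
  open import Data.List.Properties using (map-∘; map-id-local; map-++; map-tabulate; ∷-injectiveˡ)
  import Data.List.Relation.Unary.All as All
  open import Relation.Binary.PropositionalEquality
  open import Relation.Binary.Definitions using (tri<; tri≈; tri>)
  open import Relation.Nullary using (Dec; yes; no; ¬_)
  open import Relation.Nullary.Decidable using (⌊_⌋)
  open import Function using (case_of_; _∘_)

  index : ∀ {m} → Maybe (Fin m) → ℕ
  index nothing = zero
  index (just f) = suc (toℕ f)

  index-toV : ∀ {m} (f : Fin (suc m)) → index (toV f) ≡ toℕ f
  index-toV fzero = refl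
  index-toV (fsuc _) = refl

  index-nxt : ∀ {m} (f : Fin (suc m)) → (toℕ f < m × index (nxt f) ≡ suc (toℕ f)) ⊎ (toℕ f ≡ m × nxt f ≡ nothing)
  index-nxt {zero} fzero = inj₂ (refl , refl)
  index-nxt {suc m} fzero = inj₁ (s≤s z≤n , refl)
  index-nxt {suc m} (fsuc f) with index-nxt {m} f
  ... | inj₁ (f<m , eq) = inj₁ (s≤s f<m , index-map-fsuc (nxt f) eq)
    where
    index-map-fsuc : ∀ (z : Maybe (Fin m)) → index z ≡ suc (toℕ f) → index (Maybe.map fsuc z) ≡ suc (suc (toℕ f))
    index-map-fsuc (just _) eq = cong suc eq
  ... | inj₂ (f≡m , eq) = inj₂ (cong suc f≡m , cong (Maybe.map fsuc) eq)

  -- Edge j of the cycle joins vertices j and j + 1 (mod m + 1); indices j > m are sent to 0.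
  toEdge : (m : ℕ) → ℕ → Fin (suc m)
  toEdge m zero = fzero
  toEdge zero (suc j) = fzero
  toEdge (suc m) (suc j) = fsuc (toEdge m j)

  toℕ-toEdge : ∀ m j → j ≤ m → toℕ (toEdge m j) ≡ j
  toℕ-toEdge m zero _ = refl
  toℕ-toEdge (suc m) (suc j) (s≤s j≤m) = cong suc (toℕ-toEdge m j j≤m)

  toEdge-toℕ : ∀ m (f : Fin (suc m)) → toEdge m (toℕ f) ≡ f
  toEdge-toℕ m fzero = refl
  toEdge-toℕ (suc m) (fsuc f) = cong fsuc (toEdge-toℕ m f)

  range : ℕ → ℕ → List ℕ
  range s zero = []
  range s (suc d) = s ∷ range (suc s) d

  rangeDown : ℕ → ℕ → List ℕ
  rangeDown s zero = []
  rangeDown s (suc d) = d + s ∷ rangeDown s d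

  ∈-range⁻ : ∀ s d {y} → y ∈ range s d → s ≤ y × y < d + s
  ∈-range⁻ s (suc d) (here refl) = ≤-refl , s≤s (m≤n+m s d)
  ∈-range⁻ s (suc d) {y} (there y∈) with ∈-range⁻ (suc s) d y∈
  ... | s<y , y<d+s = <⇒≤ s<y , subst (y <_) (+-suc d s) y<d+s

  ∈-rangeDown⁻ : ∀ s d {y} → y ∈ rangeDown s d → s ≤ y × y < d + s
  ∈-rangeDown⁻ s (suc d) (here refl) = m≤n+m s d , ≤-refl
  ∈-rangeDown⁻ s (suc d) (there y∈) with ∈-rangeDown⁻ s d y∈
  ... | s≤y , y<d+s = s≤y , m≤n⇒m≤1+n y<d+s

  ∈-range⁺ : ∀ s d {x} → s ≤ x → x < d + s → x ∈ range s d
  ∈-range⁺ s zero s≤x x<s = ⊥-elim (<⇒≱ x<s s≤x)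
  ∈-range⁺ s (suc d) {x} s≤x x<d+s with s ≟ x
  ... | yes refl = here refl
  ... | no s≢x = there (∈-range⁺ (suc s) d (≤∧≢⇒< s≤x s≢x) (subst (x <_) (sym (+-suc d s)) x<d+s))

  ∈-rangeDown⁺ : ∀ s d {x} → s ≤ x → x < d + s → x ∈ rangeDown s d
  ∈-rangeDown⁺ s zero s≤x x<s = ⊥-elim (<⇒≱ x<s s≤x)
  ∈-rangeDown⁺ s (suc d) {x} s≤x x<d+s with x ≟ d + s
  ... | yes refl = here refl
  ... | no x≢d+s = there (∈-rangeDown⁺ s d s≤x (≤∧≢⇒< (≤-pred x<d+s) x≢d+s))

  range-unique : ∀ s d → Unique (range s d)
  range-unique s zero = []
  range-unique s (suc d) = ∷-unique (λ s∈ → 1+n≰n (proj₁ (∈-range⁻ (suc s) d s∈))) (range-unique (suc s) d)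

  rangeDown-unique : ∀ s d → Unique (rangeDown s d)
  rangeDown-unique s zero = []
  rangeDown-unique s (suc d) = ∷-unique (λ d+s∈ → 1+n≰n (proj₂ (∈-rangeDown⁻ s d d+s∈))) (rangeDown-unique s d)

  range-∷ʳ : ∀ s d → range s (suc d) ≡ range s d ++ d + s ∷ []
  range-∷ʳ s zero = refl
  range-∷ʳ s (suc d) = cong (s ∷_) (trans (range-∷ʳ (suc s) d) (cong (λ z → range (suc s) d ++ z ∷ []) (+-suc d s)))

  rangeDown-∷ʳ : ∀ s d → rangeDown s (suc d) ≡ rangeDown (suc s) d ++ s ∷ []
  rangeDown-∷ʳ s zero = refl
  rangeDown-∷ʳ s (suc d) = cong₂ _∷_ (sym (+-suc d s)) (rangeDown-∷ʳ s d)

  range-+ : ∀ s p q → range s (p + q) ≡ range s p ++ range (p + s) q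
  range-+ s zero q = refl
  range-+ s (suc p) q = cong (s ∷_) (trans (range-+ (suc s) p q) (cong (λ z → range (suc s) p ++ range z q) (+-suc p s)))

  range-suc : ∀ s d → range (suc s) d ≡ map suc (range s d)
  range-suc s zero = refl
  range-suc s (suc d) = cong (suc s ∷_) (range-suc (suc s) d)

  arc-total : ∀ m {lo hi} → lo < hi → hi ≤ m → suc lo + (suc (hi ∸ suc lo) + (m ∸ hi)) ≡ suc m
  arc-total m {lo} {hi} lo<hi hi≤m = cong suc (begin
    lo + (suc d + r)   ≡⟨ +-comm lo (suc d + r) ⟩
    (suc d + r) + lo   ≡⟨ cong (_+ lo) (+-comm (suc d) r) ⟩
    (r + suc d) + lo   ≡⟨ +-assoc r (suc d) lo ⟩
    r + (suc d + lo)   ≡⟨ cong (r +_) (trans (sym (+-suc d lo)) (m∸n+n≡m lo<hi)) ⟩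
    r + hi             ≡⟨ +-comm r hi ⟩
    hi + r             ≡⟨ m+[n∸m]≡n hi≤m ⟩
    m ∎)
    where
    open ≡-Reasoning
    d = hi ∸ suc lo
    r = m ∸ hi

  toEdge-range : ∀ k → map (toEdge k) (range 0 (suc k)) ≡ allFin (suc k)
  toEdge-range zero = refl
  toEdge-range (suc k) = cong (fzero ∷_) (begin
    map (toEdge (suc k)) (range 1 (suc k))         ≡⟨ cong (map (toEdge (suc k))) (range-suc 0 (suc k)) ⟩
    map (toEdge (suc k)) (map suc (range 0 (suc k))) ≡⟨ map-∘ (range 0 (suc k)) ⟨
    map (λ x → fsuc (toEdge k x)) (range 0 (suc k)) ≡⟨ map-∘ (range 0 (suc k)) ⟩
    map fsuc (map (toEdge k) (range 0 (suc k)))    ≡⟨ cong (map fsuc) (toEdge-range k) ⟩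
    map fsuc (allFin (suc k))                      ≡⟨ map-tabulate (λ x → x) fsuc ⟩
    tabulate fsuc ∎)
    where open ≡-Reasoning

  module CycleGeometry (m : ℕ) where

    C : RGraph
    C = cycleGraph m

    edge : ℕ → Fin (suc m)
    edge = toEdge m

    vertex : ℕ → Vx C
    vertex x = toV (edge x)

    index-vertex : ∀ {x} → x ≤ m → index (vertex x) ≡ x
    index-vertex {x} x≤m = trans (index-toV (edge x)) (toℕ-toEdge m x x≤m)

    vertex-index : ∀ z → vertex (index z) ≡ z
    vertex-index nothing = refl
    vertex-index (just f) = vertex-suc m f
      where
      vertex-suc : ∀ m (f : Fin m) → toV (toEdge m (suc (toℕ f))) ≡ just f
      vertex-suc (suc m) f = cong just (toEdge-toℕ m f)

    vertex-injective : ∀ {x y} → x ≤ m → y ≤ m → vertex x ≡ vertex y → x ≡ y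
    vertex-injective x≤m y≤m eq = trans (sym (index-vertex x≤m)) (trans (cong index eq) (index-vertex y≤m))

    edge-injective : ∀ {x y} → x ≤ m → y ≤ m → edge x ≡ edge y → x ≡ y
    edge-injective {x} {y} x≤m y≤m eq = trans (sym (toℕ-toEdge m x x≤m)) (trans (cong toℕ eq) (toℕ-toEdge m y y≤m))

    nxt-edge : ∀ {j} → j < m → nxt (edge j) ≡ vertex (suc j)
    nxt-edge {j} j<m with index-nxt (edge j)
    ... | inj₁ (_ , eq) = trans (sym (vertex-index (nxt (edge j)))) (cong vertex (trans eq (cong suc (toℕ-toEdge m j (<⇒≤ j<m)))))
    ... | inj₂ (eq , _) = ⊥-elim (<⇒≢ j<m (trans (sym (toℕ-toEdge m j (<⇒≤ j<m))) eq))

    nxt-lastEdge : nxt (edge m) ≡ nothing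
    nxt-lastEdge with index-nxt (edge m)
    ... | inj₁ (m<m , _) = ⊥-elim (<⇒≢ m<m (toℕ-toEdge m m ≤-refl))
    ... | inj₂ (_ , eq) = eq

    Joins-forward : ∀ {j} → j < m → Joins C (edge j) (vertex j) (vertex (suc j))
    Joins-forward {j} j<m = inj₁ (cong (vertex j ,_) (nxt-edge j<m))

    Joins-backward : ∀ {j} → j < m → Joins C (edge j) (vertex (suc j)) (vertex j)
    Joins-backward {j} j<m = inj₂ (cong (vertex j ,_) (nxt-edge j<m))

    Joins-wrap : Joins C (edge m) (vertex 0) (vertex m)
    Joins-wrap = inj₂ (cong (vertex m ,_) nxt-lastEdge)

    without-true : ∀ {k e : Fin (suc m)} → e ≢ k → without k e ≡ true
    without-true {k} {e} e≢k with e ≟F k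
    ... | yes e≡k = ⊥-elim (e≢k e≡k)
    ... | no _ = refl

    without₂-true : ∀ {k k′ e : Fin (suc m)} → e ≢ k → e ≢ k′ → without₂ k k′ e ≡ true
    without₂-true {k} {k′} {e} e≢k e≢k′ with e ≟F k | e ≟F k′
    ... | yes e≡k | _ = ⊥-elim (e≢k e≡k)
    ... | no _ | yes e≡k′ = ⊥-elim (e≢k′ e≡k′)
    ... | no _ | no _ = refl

    verts-cycle : verts C ≡ map vertex (range 0 (suc m))
    verts-cycle = cong (nothing ∷_) (sym (nonroot-range m))
      where
      open ≡-Reasoning
      nonroot-range : ∀ k → map (λ x → toV (toEdge k x)) (range 1 k) ≡ map just (allFin k)
      nonroot-range zero = refl
      nonroot-range (suc k) = begin
        map (λ x → toV (toEdge (suc k) x)) (range 1 (suc k))          ≡⟨ cong (map (λ x → toV (toEdge (suc k) x))) (range-suc 0 (suc k)) ⟩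
        map (λ x → toV (toEdge (suc k) x)) (map suc (range 0 (suc k))) ≡⟨ map-∘ (range 0 (suc k)) ⟨
        map (λ x → just (toEdge k x)) (range 0 (suc k))               ≡⟨ map-∘ (range 0 (suc k)) ⟩
        map just (map (toEdge k) (range 0 (suc k)))                   ≡⟨ cong (map just) (toEdge-range k) ⟩
        map just (allFin (suc k)) ∎

    without-edge-toℕ : ∀ {T : E C → Bool} k → (∀ e → T e ≡ without k e) → ∀ e → T e ≡ without (edge (toℕ k)) e
    without-edge-toℕ k T≗ e = trans (T≗ e) (cong (λ k′ → without k′ e) (sym (toEdge-toℕ m k)))

    edge-≢ : ∀ {j k} → j ≤ m → k ≤ m → j ≢ k → edge j ≢ edge k
    edge-≢ j≤m k≤m j≢k eq = j≢k (edge-injective j≤m k≤m eq)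

    vertices-unique : ∀ xs → (∀ {x} → x ∈ xs → x ≤ m) → Unique xs → Unique (map vertex xs)
    vertices-unique xs bounded u = Unique-map⁻ (subst Unique (sym index∘vertex) u)
      where
      index∘vertex : map index (map vertex xs) ≡ xs
      index∘vertex = trans (sym (map-∘ xs)) (map-id-local (All.tabulate λ x∈ → index-vertex (bounded x∈)))

    module _ {T : E C → Bool} where

      forwardWalk : ∀ s d t → d + s ≡ t → t ≤ m → (∀ j → j ∈ range s d → T (edge j) ≡ true) → Walk C T (vertex s) (vertex t)
      forwardWalk s zero t refl _ _ = []
      forwardWalk s (suc d) t d+s≡t t≤m open′ =
        step (edge s) (open′ s (here refl)) (Joins-forward (≤-trans (s≤s (m≤n+m s d)) (subst (_≤ m) (sym d+s≡t) t≤m)))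
             (forwardWalk (suc s) d t (trans (+-suc d s) d+s≡t) t≤m (λ j j∈ → open′ j (there j∈)))

      edgesW-forwardWalk : ∀ s d t eq t≤m open′ → edgesW C (forwardWalk s d t eq t≤m open′) ≡ map edge (range s d)
      edgesW-forwardWalk s zero t refl _ _ = refl
      edgesW-forwardWalk s (suc d) t eq t≤m _ = cong (edge s ∷_) (edgesW-forwardWalk (suc s) d t (trans (+-suc d s) eq) t≤m _)

      vertsW-forwardWalk : ∀ s d t eq t≤m open′ → vertsW C (forwardWalk s d t eq t≤m open′) ≡ map vertex (range s (suc d))
      vertsW-forwardWalk s zero t refl _ _ = refl
      vertsW-forwardWalk s (suc d) t eq t≤m _ = cong (vertex s ∷_) (vertsW-forwardWalk (suc s) d t (trans (+-suc d s) eq) t≤m _)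

      forwardWalk-isPath : ∀ s d t eq t≤m open′ → IsPath C (forwardWalk s d t eq t≤m open′)
      forwardWalk-isPath s d t eq t≤m open′ = subst Unique (sym (vertsW-forwardWalk s d t eq t≤m open′))
        (vertices-unique (range s (suc d)) (λ x∈ → ≤-trans (≤-pred (proj₂ (∈-range⁻ s (suc d) x∈))) (subst (_≤ m) (sym eq) t≤m))
                         (range-unique s (suc d)))

      backwardWalk : ∀ s d t → d + s ≡ t → t ≤ m → (∀ j → j ∈ rangeDown s d → T (edge j) ≡ true) → Walk C T (vertex t) (vertex s)
      backwardWalk s zero t refl _ _ = []
      backwardWalk s (suc d) t refl t≤m open′ =
        step (edge (d + s)) (open′ _ (here refl)) (Joins-backward t≤m)
             (backwardWalk s d (d + s) refl (<⇒≤ t≤m) (λ j j∈ → open′ j (there j∈)))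

      edgesW-backwardWalk : ∀ s d t eq t≤m open′ → edgesW C (backwardWalk s d t eq t≤m open′) ≡ map edge (rangeDown s d)
      edgesW-backwardWalk s zero t refl _ _ = refl
      edgesW-backwardWalk s (suc d) t refl t≤m _ = cong (edge (d + s) ∷_) (edgesW-backwardWalk s d (d + s) refl (<⇒≤ t≤m) _)

      vertsW-backwardWalk : ∀ s d t eq t≤m open′ → vertsW C (backwardWalk s d t eq t≤m open′) ≡ map vertex (rangeDown s (suc d))
      vertsW-backwardWalk s zero t refl _ _ = refl
      vertsW-backwardWalk s (suc d) t refl t≤m _ = cong (vertex (suc (d + s)) ∷_) (vertsW-backwardWalk s d (d + s) refl (<⇒≤ t≤m) _)

      backwardWalk-isPath : ∀ s d t eq t≤m open′ → IsPath C (backwardWalk s d t eq t≤m open′)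
      backwardWalk-isPath s d t eq t≤m open′ = subst Unique (sym (vertsW-backwardWalk s d t eq t≤m open′))
        (vertices-unique (rangeDown s (suc d)) (λ x∈ → ≤-trans (≤-pred (proj₂ (∈-rangeDown⁻ s (suc d) x∈))) (subst (_≤ m) (sym eq) t≤m))
                         (rangeDown-unique s (suc d)))

      wrapWalk : ∀ x d → d + x ≡ m → (∀ j → j ∈ m ∷ rangeDown x d → T (edge j) ≡ true) → Walk C T (vertex 0) (vertex x)
      wrapWalk x d eq open′ = step (edge m) (open′ m (here refl)) Joins-wrap (backwardWalk x d m eq ≤-refl (λ j j∈ → open′ j (there j∈)))

      edgesW-wrapWalk : ∀ x d eq open′ → edgesW C (wrapWalk x d eq open′) ≡ map edge (m ∷ rangeDown x d)
      edgesW-wrapWalk x d eq _ = cong (edge m ∷_) (edgesW-backwardWalk x d m eq ≤-refl _)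

      wrapWalk-isPath : ∀ x d eq open′ → 1 ≤ x → IsPath C (wrapWalk x d eq open′)
      wrapWalk-isPath x d eq open′ 1≤x = ∷-unique root∉ (backwardWalk-isPath x d m eq ≤-refl _)
        where
        root∉ : vertex 0 ∉ vertsW C (backwardWalk x d m eq ≤-refl _)
        root∉ root∈ with ∈-map⁻ vertex (subst (vertex 0 ∈_) (vertsW-backwardWalk x d m eq ≤-refl _) root∈)
        ... | y , y∈ , 0≡y with ∈-rangeDown⁻ x (suc d) y∈
        ...   | x≤y , y≤d+x with vertex-injective z≤n (≤-trans (≤-pred y≤d+x) (≤-reflexive eq)) 0≡y
        ...     | refl = case ≤-trans 1≤x x≤y of λ ()

    forward-avoids : ∀ {k x} → k ≤ m → x ≤ k → ∀ j → j ∈ range 0 x → without (edge k) (edge j) ≡ true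
    forward-avoids {k} {x} k≤m x≤k j j∈ with ∈-range⁻ 0 x j∈
    ... | _ , j<x+0 = without-true (edge-≢ (≤-trans (<⇒≤ j<x) (≤-trans x≤k k≤m)) k≤m (<⇒≢ (≤-trans j<x x≤k)))
      where
      j<x : j < x
      j<x = subst (j <_) (+-identityʳ x) j<x+0

    wrap-avoids : ∀ {k x} → k ≤ m → x ≤ m → k < x → ∀ j → j ∈ m ∷ rangeDown x (m ∸ x) → without (edge k) (edge j) ≡ true
    wrap-avoids k≤m x≤m k<x j (here refl) = without-true (edge-≢ ≤-refl k≤m (λ m≡k → <⇒≢ (≤-trans k<x x≤m) (sym m≡k)))
    wrap-avoids {x = x} k≤m x≤m k<x j (there j∈) with ∈-rangeDown⁻ x (m ∸ x) j∈
    ... | x≤j , j<m =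
      without-true (edge-≢ (≤-trans (<⇒≤ j<m) (≤-reflexive (m∸n+n≡m x≤m))) k≤m (λ j≡k → <⇒≢ (≤-trans k<x x≤j) (sym j≡k)))

    rootEdges : ℕ → ℕ → List ℕ
    rootEdges k x = if ⌊ x ≤? k ⌋ then range 0 x else m ∷ rangeDown x (m ∸ x)

    rootEdges-≤ : ∀ {k x} → x ≤ k → rootEdges k x ≡ range 0 x
    rootEdges-≤ {k} {x} x≤k with x ≤? k
    ... | yes _ = refl
    ... | no x≰k = ⊥-elim (x≰k x≤k)

    rootEdges-> : ∀ {k x} → k < x → rootEdges k x ≡ m ∷ rangeDown x (m ∸ x)
    rootEdges-> {k} {x} k<x with x ≤? k
    ... | yes x≤k = ⊥-elim (<⇒≱ k<x x≤k)
    ... | no _ = refl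

    module _ {k x} (k≤m : k ≤ m) (x≤m : x ≤ m) where

      rootWalk : Walk C (without (edge k)) (vertex 0) (vertex x)
      rootWalk with x ≤? k
      ... | yes x≤k = forwardWalk 0 x x (+-identityʳ x) x≤m (forward-avoids k≤m x≤k)
      ... | no x≰k = wrapWalk x (m ∸ x) (m∸n+n≡m x≤m) (wrap-avoids k≤m x≤m (≰⇒> x≰k))

      edgesW-rootWalk : edgesW C rootWalk ≡ map edge (rootEdges k x)
      edgesW-rootWalk with x ≤? k
      ... | yes x≤k = edgesW-forwardWalk 0 x x (+-identityʳ x) x≤m (forward-avoids k≤m x≤k)
      ... | no x≰k = edgesW-wrapWalk x (m ∸ x) (m∸n+n≡m x≤m) (wrap-avoids k≤m x≤m (≰⇒> x≰k))

      rootWalk-isPath : IsPath C rootWalk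
      rootWalk-isPath with x ≤? k
      ... | yes x≤k = forwardWalk-isPath 0 x x (+-identityʳ x) x≤m (forward-avoids k≤m x≤k)
      ... | no x≰k = wrapWalk-isPath x (m ∸ x) (m∸n+n≡m x≤m) (wrap-avoids k≤m x≤m (≰⇒> x≰k)) (≤-trans (s≤s z≤n) (≰⇒> x≰k))

    module _ {T : E C → Bool} (st : IsSpanningTree C T) where

      private
        ⌊⌋-≡ : ∀ {P Q : Set} (p : Dec P) (q : Dec Q) → (P → Q) → (Q → P) → ⌊ p ⌋ ≡ ⌊ q ⌋
        ⌊⌋-≡ (yes _) (yes _) _ _ = refl
        ⌊⌋-≡ (yes p) (no ¬q) f _ = ⊥-elim (¬q (f p))
        ⌊⌋-≡ (no ¬p) (yes q) _ g = ⊥-elim (¬p (g q))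
        ⌊⌋-≡ (no _) (no _) _ _ = refl

        ⌊⌋-false : ∀ {P : Set} (p : Dec P) → ¬ P → ⌊ p ⌋ ≡ false
        ⌊⌋-false (yes p) ¬p = ⊥-elim (¬p p)
        ⌊⌋-false (no _) _ = refl

        ⌊⌋-true : ∀ {P : Set} (p : Dec P) → P → ⌊ p ⌋ ≡ true
        ⌊⌋-true (yes _) _ = refl
        ⌊⌋-true (no ¬p) p = ⊥-elim (¬p p)

      -- If T avoided two edges lo < hi, no T-edge would leave the arc of vertices lo+1, …, hi.
      twoMissing-disconnects : ∀ lo hi → lo < hi → hi ≤ m → (∀ e → T e ≡ true → toℕ e ≢ lo × toℕ e ≢ hi) → ⊥
      twoMissing-disconnects lo hi lo<hi hi≤m avoids = case trans (sym (onArc-0)) (trans (onArc-walk (rootToArc)) onArc-arc) of λ ()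
        where
        onArc : ℕ → Bool
        onArc y = ⌊ suc lo ≤? y ⌋ ∧ ⌊ y ≤? hi ⌋

        onArc-0 : onArc 0 ≡ false
        onArc-0 = cong (_∧ ⌊ 0 ≤? hi ⌋) (⌊⌋-false (suc lo ≤? 0) λ ())

        onArc-arc : onArc (index (vertex (suc lo))) ≡ true
        onArc-arc = trans (cong onArc (index-vertex (≤-trans lo<hi hi≤m)))
                          (cong₂ _∧_ (⌊⌋-true (suc lo ≤? suc lo) ≤-refl) (⌊⌋-true (suc lo ≤? hi) lo<hi))

        onArc-suc : ∀ j → j ≢ lo → j ≢ hi → onArc j ≡ onArc (suc j)
        onArc-suc j j≢lo j≢hi =
          cong₂ _∧_ (⌊⌋-≡ (suc lo ≤? j) (suc lo ≤? suc j) m≤n⇒m≤1+n (λ lo<1+j → ≤∧≢⇒< (≤-pred lo<1+j) (λ lo≡j → j≢lo (sym lo≡j))))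
                    (⌊⌋-≡ (j ≤? hi) (suc j ≤? hi) (λ j≤hi → ≤∧≢⇒< j≤hi j≢hi) <⇒≤)

        onArc-m : m ≢ hi → onArc m ≡ false
        onArc-m m≢hi = trans (cong (⌊ suc lo ≤? m ⌋ ∧_) (⌊⌋-false (m ≤? hi) (λ m≤hi → m≢hi (≤-antisym m≤hi hi≤m))))
                             (∧-zeroʳ _)

        onArc-edge : ∀ e → T e ≡ true → onArc (index (toV e)) ≡ onArc (index (nxt e))
        onArc-edge e t with index-nxt e | avoids e t
        ... | inj₁ (_ , eq) | e≢lo , e≢hi =
          trans (cong onArc (index-toV e)) (trans (onArc-suc (toℕ e) e≢lo e≢hi) (cong onArc (sym eq)))
        ... | inj₂ (e≡m , nxt≡root) | _ , e≢hi =
          trans (cong onArc (trans (index-toV e) e≡m))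
                (trans (onArc-m (λ m≡hi → e≢hi (trans e≡m m≡hi))) (trans (sym onArc-0) (cong (onArc ∘ index) (sym nxt≡root))))

        onArc-joins : ∀ {e u x} → T e ≡ true → Joins C e u x → onArc (index u) ≡ onArc (index x)
        onArc-joins {e} t (inj₁ eq) = subst₂ (λ a b → onArc (index a) ≡ onArc (index b)) (cong proj₁ eq) (cong proj₂ eq) (onArc-edge e t)
        onArc-joins {e} t (inj₂ eq) = sym (subst₂ (λ a b → onArc (index a) ≡ onArc (index b)) (cong proj₁ eq) (cong proj₂ eq) (onArc-edge e t))

        onArc-walk : ∀ {u w} → Walk C T u w → onArc (index u) ≡ onArc (index w)
        onArc-walk [] = refl
        onArc-walk (step _ t j p) = trans (onArc-joins t j) (onArc-walk p)

        rootToArc : Walk C T nothing (vertex (suc lo))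
        rootToArc = proj₁ (proj₁ st nothing (vertex (suc lo)))

      -- With every edge present, vertex 1 is reached both by edge 0 and around the cycle.
      notAllEdges : 1 ≤ m → ¬ (∀ e → T e ≡ true)
      notAllEdges 1≤m all = 0≢m (edge-injective z≤n ≤-refl (∷-injectiveˡ (proj₂ st _ _ direct around direct-isPath around-isPath)))
        where
        direct : Walk C T (vertex 0) (vertex 1)
        direct = step (edge 0) (all _) (Joins-forward 1≤m) []
        direct-isPath : IsPath C direct
        direct-isPath = ∷-unique (λ { (here 0≡1) → case vertex-injective z≤n 1≤m 0≡1 of λ () }) (∷-unique (λ ()) [])
        around : Walk C T (vertex 0) (vertex 1)
        around = wrapWalk 1 (m ∸ 1) (m∸n+n≡m 1≤m) (λ _ _ → all _)
        around-isPath : IsPath C around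
        around-isPath = wrapWalk-isPath 1 (m ∸ 1) (m∸n+n≡m 1≤m) (λ _ _ → all _) ≤-refl
        0≢m : 0 ≢ m
        0≢m 0≡m = 1+n≰n (≤-trans 1≤m (≤-reflexive (sym 0≡m)))

      missing : ∀ {d f} → T d ≡ false → T f ≡ true → toℕ f ≢ toℕ d
      missing Td≡f Tf≡t eq = case trans (sym Td≡f) (subst (λ z → T z ≡ true) (toℕ-injective eq) Tf≡t) of λ ()

      atMostOneMissing : ∀ e e′ → e ≢ e′ → T e ≡ false → T e′ ≡ false → ⊥
      atMostOneMissing e e′ e≢e′ Te≡f Te′≡f with <-cmp (toℕ e) (toℕ e′)
      ... | tri< lt _ _ = twoMissing-disconnects (toℕ e) (toℕ e′) lt (toℕ≤pred[n] e′) (λ f t → missing Te≡f t , missing Te′≡f t)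
      ... | tri≈ _ eq _ = e≢e′ (toℕ-injective eq)
      ... | tri> _ _ gt = twoMissing-disconnects (toℕ e′) (toℕ e) gt (toℕ≤pred[n] e) (λ f t → missing Te′≡f t , missing Te≡f t)

      cycle-spanningTree : 1 ≤ m → Σ (Fin (suc m)) λ k → ∀ e → T e ≡ without k e
      cycle-spanningTree 1≤m with any? (λ e → T e ≟B false)
      ... | yes (k , Tk≡f) = k , onlyMissing
        where
        onlyMissing : ∀ e → T e ≡ without k e
        onlyMissing e with e ≟F k
        ... | yes refl = Tk≡f
        ... | no e≢k with T e in Te
        ...   | true = refl
        ...   | false = ⊥-elim (atMostOneMissing e k e≢k Te Tk≡f)
      ... | no noneMissing = ⊥-elim (notAllEdges 1≤m present)
        where
        present : ∀ e → T e ≡ true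
        present e with T e in Te
        ... | true = refl
        ... | false = ⊥-elim (noneMissing (e , Te))

  module CyclePaths (m : ℕ) where

    open CycleGeometry m

    length-map-range : ∀ s d → length (map edge (range s d)) ≡ d
    length-map-range s zero = refl
    length-map-range s (suc d) = cong suc (length-map-range (suc s) d)

    length-map-rangeDown : ∀ s d → length (map edge (rangeDown s d)) ≡ d
    length-map-rangeDown s zero = refl
    length-map-rangeDown s (suc d) = cong suc (length-map-rangeDown s d)

    last-forward : ∀ a → last (map edge (range 0 (suc a))) ≡ just (edge a)
    last-forward a = trans (cong (λ l → last (map edge l)) (range-∷ʳ 0 a))
                    (trans (cong last (map-++ edge (range 0 a) (a + 0 ∷ [])))
                    (trans (last-∷ʳ (map edge (range 0 a)) (edge (a + 0))) (cong (λ z → just (edge z)) (+-identityʳ a))))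

    last-wrap : ∀ x d → d + x ≡ m → last (edge m ∷ map edge (rangeDown x d)) ≡ just (edge x)
    last-wrap x zero eq = cong (λ z → just (edge z)) (sym eq)
    last-wrap x (suc d) _ = trans (cong (λ l → last (edge m ∷ map edge l)) (rangeDown-∷ʳ x d))
                            (trans (cong (λ l → last (edge m ∷ l)) (map-++ edge (rangeDown (suc x) d) (x ∷ [])))
                            (last-∷ʳ (edge m ∷ map edge (rangeDown (suc x) d)) (edge x)))

    arc-avoids : ∀ {lo hi j} → hi ≤ m → suc lo ≤ j → j < hi → edge j ≢ edge lo × edge j ≢ edge hi
    arc-avoids hi≤m lo<j j<hi =
      edge-≢ j≤m (≤-trans (<⇒≤ (≤-trans lo<j (<⇒≤ j<hi))) hi≤m) (λ j≡lo → <⇒≢ lo<j (sym j≡lo)) ,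
      edge-≢ j≤m hi≤m (<⇒≢ j<hi)
      where
      j≤m = ≤-trans (<⇒≤ j<hi) hi≤m

    module Arc {lo hi} (lo<hi : lo < hi) (hi≤m : hi ≤ m) {T : E C → Bool}
               (open′ : ∀ {j} → suc lo ≤ j → j < hi → T (edge j) ≡ true) where

      arcLength : ℕ
      arcLength = hi ∸ suc lo

      arcLength+suc-lo : arcLength + suc lo ≡ hi
      arcLength+suc-lo = m∸n+n≡m lo<hi

      private
        open-range : ∀ j → j ∈ range (suc lo) arcLength → T (edge j) ≡ true
        open-range j j∈ with ∈-range⁻ (suc lo) arcLength j∈
        ... | lo<j , j<hi = open′ lo<j (subst (j <_) arcLength+suc-lo j<hi)

        open-rangeDown : ∀ j → j ∈ rangeDown (suc lo) arcLength → T (edge j) ≡ true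
        open-rangeDown j j∈ with ∈-rangeDown⁻ (suc lo) arcLength j∈
        ... | lo<j , j<hi = open′ lo<j (subst (j <_) arcLength+suc-lo j<hi)

      arcUp : Walk C T (vertex (suc lo)) (vertex hi)
      arcUp = forwardWalk (suc lo) arcLength hi arcLength+suc-lo hi≤m open-range

      arcDown : Walk C T (vertex hi) (vertex (suc lo))
      arcDown = backwardWalk (suc lo) arcLength hi arcLength+suc-lo hi≤m open-rangeDown

      arcUp-isPath : IsPath C arcUp
      arcUp-isPath = forwardWalk-isPath (suc lo) arcLength hi arcLength+suc-lo hi≤m open-range

      arcDown-isPath : IsPath C arcDown
      arcDown-isPath = backwardWalk-isPath (suc lo) arcLength hi arcLength+suc-lo hi≤m open-rangeDown

      edgesW-arcUp : edgesW C arcUp ≡ map edge (range (suc lo) arcLength)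
      edgesW-arcUp = edgesW-forwardWalk (suc lo) arcLength hi arcLength+suc-lo hi≤m open-range

      edgesW-arcDown : edgesW C arcDown ≡ map edge (rangeDown (suc lo) arcLength)
      edgesW-arcDown = edgesW-backwardWalk (suc lo) arcLength hi arcLength+suc-lo hi≤m open-rangeDown

      length-arcUp≡length-arcDown : length (edgesW C arcUp) ≡ length (edgesW C arcDown)
      length-arcUp≡length-arcDown = trans (cong length edgesW-arcUp) (trans (length-map-range (suc lo) arcLength)
                                      (sym (trans (cong length edgesW-arcDown) (length-map-rangeDown (suc lo) arcLength))))

      arc⊆arcUp : ∀ {x} → lo < x → x ≤ hi → vertex x ∈ vertsW C arcUp
      arc⊆arcUp lo<x x≤hi = subst (vertex _ ∈_) (sym (vertsW-forwardWalk (suc lo) arcLength hi arcLength+suc-lo hi≤m open-range))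
        (∈-map⁺ vertex (∈-range⁺ (suc lo) (suc arcLength) lo<x (s≤s (≤-trans x≤hi (≤-reflexive (sym arcLength+suc-lo))))))

      arc⊆arcDown : ∀ {x} → lo < x → x ≤ hi → vertex x ∈ vertsW C arcDown
      arc⊆arcDown lo<x x≤hi = subst (vertex _ ∈_) (sym (vertsW-backwardWalk (suc lo) arcLength hi arcLength+suc-lo hi≤m open-rangeDown))
        (∈-map⁺ vertex (∈-rangeDown⁺ (suc lo) (suc arcLength) lo<x (s≤s (≤-trans x≤hi (≤-reflexive (sym arcLength+suc-lo))))))

    rootWalk-last-forward : ∀ {k a} (k≤m : k ≤ m) (a<k : a < k) → last (edgesW C (rootWalk k≤m (≤-trans a<k k≤m))) ≡ just (edge a)
    rootWalk-last-forward {a = a} k≤m a<k =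
      trans (cong last (trans (edgesW-rootWalk k≤m (≤-trans a<k k≤m)) (cong (map edge) (rootEdges-≤ a<k)))) (last-forward a)

    rootWalk-last-backward : ∀ {k b} (k≤m : k ≤ m) (b≤m : b ≤ m) → k < b → last (edgesW C (rootWalk k≤m b≤m)) ≡ just (edge b)
    rootWalk-last-backward {b = b} k≤m b≤m k<b =
      trans (cong last (trans (edgesW-rootWalk k≤m b≤m) (cong (map edge) (rootEdges-> k<b)))) (last-wrap b (m ∸ b) (m∸n+n≡m b≤m))

module CycleCost where

  open Walks
  open Sums
  open Cycle
  open import Data.Nat using (ℕ; zero; suc; _∸_; s≤s) renaming (_+_ to _+ℕ_; _≤_ to _≤ℕ_; _<_ to _<ℕ_)
  import Data.Nat.Properties as ℕₚ
  open import Data.Fin using (Fin)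
  open import Data.Fin.Properties using () renaming (_≟_ to _≟F_)
  open import Data.Bool using (if_then_else_)
  open import Data.Empty using (⊥-elim)
  open import Data.List using (List; []; _∷_; _++_; map; length; allFin; upTo; applyUpTo; take)
  open import Data.List.Properties using (length-applyUpTo; map-++)
  open import Data.List.Membership.Propositional using (_∈_)
  open import Data.List.Membership.Propositional.Properties using (∈-allFin)
  open import Data.List.Relation.Unary.Any using (here; there)
  open import Data.List.Relation.Unary.Unique.Propositional using (Unique; _∷_)
  open import Data.List.Relation.Unary.Unique.Propositional.Properties using (allFin⁺; Unique[x∷xs]⇒x∉xs)
  open import Relation.Binary.PropositionalEquality as ≡ using (_≡_; cong)
  open import Relation.Nullary using (yes; no)

  map-applyUpTo : ∀ {X Y : Set} (F : X → Y) (f : ℕ → X) n → map F (applyUpTo f n) ≡ applyUpTo (λ i → F (f i)) n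
  map-applyUpTo F f zero = ≡.refl
  map-applyUpTo F f (suc n) = cong (F (f 0) ∷_) (map-applyUpTo F (λ i → f (suc i)) n)

  module CycleDistances (A : OrderedAbelianGroup) (m : ℕ) (γ τ : Fin (suc m) → OrderedAbelianGroup.Carrier A) where

    open OrderedAbelianGroupProperties A
    open CycleGeometry m
    open import Algebra.Solver.CommutativeMonoid +-commutativeMonoid using (solve; _⊜_; _⊕_) renaming (id to ∅)

    weight : ℕ → Carrier
    weight j = γ (edge j)

    totalWeight : List ℕ → Carrier
    totalWeight js = Lw A γ (map edge js)

    totalWeight-∷ʳ : ∀ js j → totalWeight (js ++ j ∷ []) ≈ totalWeight js + weight j
    totalWeight-∷ʳ js j = ≈-trans (≈-reflexive (cong (Lw A γ) (map-++ edge js (j ∷ []))))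
                              (≈-trans (Lw-++ γ (map edge js) (edge j ∷ [])) (+-congˡ (identityʳ (weight j))))

    dist : ℕ → ℕ → Carrier
    dist k x = totalWeight (rootEdges k x)

    dist-forward : ∀ k x → suc x ≤ℕ k → dist k (suc x) ≈ dist k x + weight x
    dist-forward k x x<k = begin
      dist k (suc x)                  ≈⟨ ≈-reflexive (cong totalWeight (rootEdges-≤ x<k)) ⟩
      totalWeight (range 0 (suc x))       ≈⟨ ≈-reflexive (cong totalWeight (range-∷ʳ 0 x)) ⟩
      totalWeight (range 0 x ++ x +ℕ 0 ∷ [])  ≈⟨ totalWeight-∷ʳ (range 0 x) (x +ℕ 0) ⟩
      totalWeight (range 0 x) + weight (x +ℕ 0)
        ≈⟨ +-cong (≈-reflexive (cong totalWeight (≡.sym (rootEdges-≤ (ℕₚ.<⇒≤ x<k))))) (≈-reflexive (cong weight (ℕₚ.+-identityʳ x))) ⟩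
      dist k x + weight x ∎

    dist-backward : ∀ k x → k <ℕ x → x <ℕ m → dist k x ≈ dist k (suc x) + weight x
    dist-backward k x k<x x<m = begin
      dist k x                                          ≈⟨ ≈-reflexive (cong totalWeight (rootEdges-> k<x)) ⟩
      totalWeight (m ∷ rangeDown x (m ∸ x))                 ≈⟨ ≈-reflexive (cong (λ d → totalWeight (m ∷ rangeDown x d)) (∸-suc x<m)) ⟩
      weight m + totalWeight (rangeDown x (suc (m ∸ suc x)))  ≈⟨ +-congˡ (≈-reflexive (cong totalWeight (rangeDown-∷ʳ x (m ∸ suc x)))) ⟩
      weight m + totalWeight (rangeDown (suc x) (m ∸ suc x) ++ x ∷ [])  ≈⟨ +-congˡ (totalWeight-∷ʳ (rangeDown (suc x) (m ∸ suc x)) x) ⟩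
      weight m + (totalWeight (rangeDown (suc x) (m ∸ suc x)) + weight x)  ≈⟨ assoc _ _ _ ⟨
      totalWeight (m ∷ rangeDown (suc x) (m ∸ suc x)) + weight x
        ≈⟨ +-congʳ (≈-reflexive (cong totalWeight (≡.sym (rootEdges-> (ℕₚ.≤-trans k<x (ℕₚ.n≤1+n x)))))) ⟩
      dist k (suc x) + weight x ∎
      where
      ∸-suc : ∀ {m x} → x <ℕ m → m ∸ x ≡ suc (m ∸ suc x)
      ∸-suc {suc m} {zero} _ = ≡.refl
      ∸-suc {suc m} {suc x} (s≤s x<m) = ∸-suc x<m

    prefixSums : Carrier → List (Fin (suc m)) → Carrier
    prefixSums ℓ [] = ℓ
    prefixSums ℓ (e ∷ es) = ℓ + prefixSums (ℓ + γ e) es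

    Cw-∷ : ∀ e es → Cw A γ (e ∷ es) ≈ (γ e + 0#) + (length es · γ e + Cw A γ es)
    Cw-∷ e es = +-congˡ (begin
      sumA (map F (applyUpTo suc n))                          ≈⟨ ≈-reflexive (cong sumA (map-applyUpTo F suc n)) ⟩
      sumA (applyUpTo (λ i → F (suc i)) n)                    ≈⟨ ≈-reflexive (cong sumA (map-applyUpTo (λ i → F (suc i)) (λ i → i) n)) ⟨
      sumA (map (λ i → γ e + Lw A γ (take (suc i) es)) (upTo n))
        ≈⟨ sumA-+ (λ _ → γ e) (λ i → Lw A γ (take (suc i) es)) (upTo n) ⟩
      sumA (map (λ _ → γ e) (upTo n)) + Cw A γ es             ≈⟨ +-congʳ (sumA-const (γ e) (upTo n)) ⟩
      length (upTo n) · γ e + Cw A γ es                       ≈⟨ +-congʳ (≈-reflexive (cong (_· γ e) (length-applyUpTo (λ i → i) n))) ⟩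
      n · γ e + Cw A γ es ∎)
      where
      n = length es
      F : ℕ → Carrier
      F i = Lw A γ (take (suc i) (e ∷ es))

    prefixSums≈ : ∀ ℓ es → prefixSums ℓ es ≈ ℓ + (length es · ℓ + Cw A γ es)
    prefixSums≈ ℓ [] = ≈-sym (≈-trans (+-congˡ (identityˡ _)) (identityʳ ℓ))
    prefixSums≈ ℓ (e ∷ es) = begin
      ℓ + prefixSums (ℓ + γ e) es                     ≈⟨ +-congˡ (prefixSums≈ (ℓ + γ e) es) ⟩
      ℓ + ((ℓ + γ e) + (n · (ℓ + γ e) + Cs))         ≈⟨ +-congˡ (+-congˡ (+-congʳ (·-distrib-+ n ℓ (γ e)))) ⟩
      ℓ + ((ℓ + γ e) + ((n · ℓ + n · γ e) + Cs))     ≈⟨ +-congˡ (regroup ℓ (γ e) (n · ℓ) (n · γ e) Cs) ⟩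
      ℓ + ((ℓ + n · ℓ) + ((γ e + 0#) + (n · γ e + Cs))) ≈⟨ +-congˡ (+-congˡ (Cw-∷ e es)) ⟨
      ℓ + (suc n · ℓ + Cw A γ (e ∷ es)) ∎
      where
      n = length es
      Cs = Cw A γ es
      regroup : ∀ a b c d f → (a + b) + ((c + d) + f) ≈ (a + c) + ((b + 0#) + (d + f))
      regroup = solve 5 (λ a b c d f → (a ⊕ b) ⊕ ((c ⊕ d) ⊕ f) ⊜ (a ⊕ c) ⊕ ((b ⊕ ∅) ⊕ (d ⊕ f))) ≈-refl

    sum-forward : ∀ (D : ℕ → Carrier) s d ℓ → D s ≈ ℓ → (∀ i → s ≤ℕ i → i <ℕ d +ℕ s → D (suc i) ≈ D i + weight i) →
                  sumA (map D (range s (suc d))) ≈ prefixSums ℓ (map edge (range s d))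
    sum-forward D s zero ℓ Ds≈ℓ _ = ≈-trans (identityʳ (D s)) Ds≈ℓ
    sum-forward D s (suc d) ℓ Ds≈ℓ next = +-cong Ds≈ℓ (sum-forward D (suc s) d (ℓ + weight s)
      (≈-trans (next s ℕₚ.≤-refl (s≤s (ℕₚ.m≤n+m s d))) (+-congʳ Ds≈ℓ))
      (λ i s<i i<d+s → next i (ℕₚ.≤-trans (ℕₚ.n≤1+n s) s<i) (≡.subst (i <ℕ_) (ℕₚ.+-suc d s) i<d+s)))

    sum-backward : ∀ (D : ℕ → Carrier) s d ℓ → D (d +ℕ s) ≈ ℓ → (∀ i → s ≤ℕ i → i <ℕ d +ℕ s → D i ≈ D (suc i) + weight i) →
                   sumA (map D (range s (suc d))) ≈ prefixSums ℓ (map edge (rangeDown s d))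
    sum-backward D s zero ℓ Ds≈ℓ _ = ≈-trans (identityʳ (D s)) Ds≈ℓ
    sum-backward D s (suc d) ℓ Dt≈ℓ next = begin
      sumA (map D (range s (suc (suc d))))
        ≈⟨ ≈-reflexive (cong (λ l → sumA (map D l)) (≡.trans (cong (range s) (ℕₚ.+-comm 1 (suc d))) (range-+ s (suc d) 1))) ⟩
      sumA (map D (range s (suc d) ++ range (suc d +ℕ s) 1))    ≈⟨ sumA-map-++ D (range s (suc d)) (range (suc d +ℕ s) 1) ⟩
      sumA (map D (range s (suc d))) + (D (suc d +ℕ s) + 0#)   ≈⟨ +-cong rest (≈-trans (identityʳ _) Dt≈ℓ) ⟩
      prefixSums (ℓ + weight (d +ℕ s)) (map edge (rangeDown s d)) + ℓ ≈⟨ comm _ _ ⟩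
      ℓ + prefixSums (ℓ + weight (d +ℕ s)) (map edge (rangeDown s d)) ∎
      where
      rest = sum-backward D s d (ℓ + weight (d +ℕ s)) (≈-trans (next (d +ℕ s) (ℕₚ.m≤n+m s d) ℕₚ.≤-refl) (+-congʳ Dt≈ℓ))
               (λ i s≤i i<d+s → next i s≤i (ℕₚ.≤-trans i<d+s (ℕₚ.n≤1+n _)))

    edgeCost-without : (k : Fin (suc m)) → Carrier
    edgeCost-without k = sumA (map (λ e → if without k e then τ e else 0#) (allFin (suc m)))

    edgeCost-without+τ : ∀ k → edgeCost-without k + τ k ≈ sumA (map τ (allFin (suc m)))
    edgeCost-without+τ k = go (allFin (suc m)) (allFin⁺ (suc m)) (∈-allFin k)
      where
      f : Fin (suc m) → Carrier
      f e = if without k e then τ e else 0#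
      go : ∀ es → Unique es → k ∈ es → sumA (map f es) + τ k ≈ sumA (map τ es)
      go (e ∷ es) u k∈ with e ≟F k
      ... | yes ≡.refl = begin
        (0# + sumA (map f es)) + τ k  ≈⟨ +-congʳ (identityˡ _) ⟩
        sumA (map f es) + τ k         ≈⟨ +-congʳ (sumA-cong es λ x x∈ → ≈-reflexive (cong (λ b → if b then τ x else 0#)
                                           (without-true (λ x≡k → Unique[x∷xs]⇒x∉xs u (≡.subst (_∈ es) x≡k x∈))))) ⟩
        sumA (map τ es) + τ k         ≈⟨ comm _ _ ⟩
        τ k + sumA (map τ es) ∎
      ... | no e≢k = begin
        (τ e + sumA (map f es)) + τ k ≈⟨ assoc _ _ _ ⟩
        τ e + (sumA (map f es) + τ k) ≈⟨ +-congˡ (go es (tail u) (later k∈)) ⟩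
        τ e + sumA (map τ es) ∎
        where
        tail : Unique (e ∷ es) → Unique es
        tail (_ ∷ u) = u
        later : k ∈ e ∷ es → k ∈ es
        later (here k≡e) = ⊥-elim (e≢k (≡.sym k≡e))
        later (there k∈) = k∈

module Exchange where

  open Walks
  open Sums
  open Cycle
  open CycleCost
  open Wedge
  open WedgeCost
  open import Data.Nat using (ℕ; suc; _∸_; _≤?_; _<?_) renaming (_≟_ to _≟ℕ_; _+_ to _+ℕ_; _≤_ to _≤ℕ_; _<_ to _<ℕ_)
  import Data.Nat.Properties as ℕₚ
  open import Data.Fin using (Fin; toℕ)
  open import Data.Fin.Properties using (toℕ<n; toℕ≤pred[n]) renaming (_≟_ to _≟F_)
  open import Data.Bool using (Bool; true; false; _∨_; if_then_else_)
  open import Data.Bool.Properties using (∨-zeroʳ)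
  open import Data.Maybe using (Maybe; just; nothing)
  open import Data.Maybe.Properties using () renaming (≡-dec to ≡-decMaybe)
  open import Data.Product using (Σ; _,_; proj₁; proj₂)
  open import Data.Empty using (⊥-elim)
  open import Data.List using (List; _∷_; _++_; map; length; allFin; last)
  open import Data.List.Properties using (map-cong)
  open import Data.List.Membership.Propositional using (_∈_)
  open import Data.List.Relation.Unary.Any using (here; there)
  open import Relation.Binary.PropositionalEquality as ≡ using (_≡_; _≢_; cong)
  open import Relation.Nullary using (yes; no)
  open import Relation.Nullary.Decidable using (⌊_⌋)
  open import Function using (case_of_)
  open import Relation.Binary.Definitions using (tri<; tri≈; tri>)
  import Algebra.Solver.CommutativeMonoid

  inList-∈ : ∀ {m} {z : Maybe (Fin m)} {l} → z ∈ l → inList z l ≡ true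
  inList-∈ {z = z} {y ∷ _} (here ≡.refl) with ≡-decMaybe _≟F_ z z
  ... | yes _ = ≡.refl
  ... | no z≢z = ⊥-elim (z≢z ≡.refl)
  inList-∈ {z = z} {y ∷ _} (there z∈) = ≡.trans (cong (⌊ ≡-decMaybe _≟F_ z y ⌋ ∨_) (inList-∈ z∈)) (∨-zeroʳ _)

  module Potential (A : OrderedAbelianGroup) (m : ℕ) (γ τ : Fin (suc m) → OrderedAbelianGroup.Carrier A)
                  {n : ℕ} (v : Fin n → Fin m) (size : Fin n → ℕ) where

    open OrderedAbelianGroupProperties A
    open CycleGeometry m
    open CycleDistances A m γ τ

    position : Fin n → ℕ
    position i = suc (toℕ (v i))

    position≤m : ∀ i → position i ≤ℕ m
    position≤m i = toℕ<n (v i)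

    distSum : ℕ → ℕ → ℕ → Carrier
    distSum k s c = sumA (map (dist k) (range s c))

    hangingDist : ℕ → Carrier
    hangingDist k = sumA (map (λ i → size i · dist k (position i)) (allFin n))

    potential : ℕ → Carrier
    potential k = edgeCost-without (edge k) + (distSum k 0 (suc m) + hangingDist k)

    ExchangeCondition : Fin (suc m) → Fin (suc m) → Set
    ExchangeCondition e₁ e₂ = (b₁ b₂ : Maybe (Fin m)) →
        (P₁ : Walk C (without e₂) nothing b₁) → IsPath C P₁ →
        last (edgesW C P₁) ≡ just e₁ →
        (P₂ : Walk C (without e₁) nothing b₂) → IsPath C P₂ →
        last (edgesW C P₂) ≡ just e₂ →
        (Q⁺ : Walk C (without₂ e₁ e₂) b₂ b₁) → IsPath C Q⁺ →
        (Q⁻ : Walk C (without₂ e₁ e₂) b₁ b₂) → IsPath C Q⁻ →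
        (R₁ : (j : Fin n) → Σ (Walk C (without e₁) nothing (just (v j))) (IsPath C)) →
        (R₂ : (j : Fin n) → Σ (Walk C (without e₂) nothing (just (v j))) (IsPath C)) →
        τ e₂ - τ e₁
          + (Lw A γ (edgesW C P₂) - Lw A γ (edgesW C P₁))
          + length (edgesW C Q⁺)
              · (Lw A γ (edgesW C P₂) - Lw A γ (edgesW C P₁))
          + Cw A γ (edgesW C Q⁺) - Cw A γ (edgesW C Q⁻)
          + sumA (map (λ j → if inList (just (v j)) (vertsW C Q⁺)
                               then size j
                                      · (Lw A γ (edgesW C (proj₁ (R₁ j)))
                                         - Lw A γ (edgesW C (proj₁ (R₂ j))))
                               else 0#)
                      (allFin n))
          ≤ 0#

    rootPathTo : ∀ {k} → k ≤ℕ m → (i : Fin n) → Σ (Walk C (without (edge k)) nothing (just (v i))) (IsPath C)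
    rootPathTo k≤m i = castPath C ≡.refl (vertex-index (just (v i))) (rootWalk k≤m (position≤m i) , rootWalk-isPath k≤m (position≤m i))

    length-rootPathTo : ∀ {k} (k≤m : k ≤ℕ m) i → Lw A γ (edgesW C (proj₁ (rootPathTo k≤m i))) ≈ dist k (position i)
    length-rootPathTo k≤m i = ≈-reflexive (cong (Lw A γ)
      (≡.trans (edgesW-castPath C ≡.refl (vertex-index (just (v i))) _) (edgesW-rootWalk k≤m (position≤m i))))

    dist-below : ∀ {a b x} → x ≤ℕ a → x ≤ℕ b → dist a x ≡ dist b x
    dist-below x≤a x≤b = cong totalWeight (≡.trans (rootEdges-≤ x≤a) (≡.sym (rootEdges-≤ x≤b)))

    dist-above : ∀ {a b x} → a <ℕ x → b <ℕ x → dist a x ≡ dist b x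
    dist-above a<x b<x = cong totalWeight (≡.trans (rootEdges-> a<x) (≡.sym (rootEdges-> b<x)))

    hangingDist-split : ∀ {a b lo hi} (a≤m : a ≤ℕ m) (b≤m : b ≤ℕ m) → lo ≤ℕ a → lo ≤ℕ b → a ≤ℕ hi → b ≤ℕ hi →
      (l : List (Maybe (Fin m))) → (∀ x → lo <ℕ x → x ≤ℕ hi → vertex x ∈ l) →
      hangingDist a ≈ hangingDist b +
        sumA (map (λ j → if inList (just (v j)) l
                           then size j · (Lw A γ (edgesW C (proj₁ (rootPathTo a≤m j))) - Lw A γ (edgesW C (proj₁ (rootPathTo b≤m j))))
                           else 0#) (allFin n))
    hangingDist-split {a} {b} {lo} {hi} a≤m b≤m lo≤a lo≤b a≤hi b≤hi l between∈l =
      ≈-trans (sumA-cong (allFin n) (λ i _ → term i)) (sumA-+ _ _ (allFin n))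
      where
      term : ∀ i → size i · dist a (position i) ≈ size i · dist b (position i) +
               (if inList (just (v i)) l
                  then size i · (Lw A γ (edgesW C (proj₁ (rootPathTo a≤m i))) - Lw A γ (edgesW C (proj₁ (rootPathTo b≤m i))))
                  else 0#)
      term i with inList (just (v i)) l in v∈l
      ... | true = begin
        size i · dist a (position i)                                   ≈⟨ ·-cong (size i) (x≈y+[x-y] _ _) ⟩
        size i · (dist b (position i) + (dist a (position i) - dist b (position i)))  ≈⟨ ·-distrib-+ (size i) _ _ ⟩
        size i · dist b (position i) + size i · (dist a (position i) - dist b (position i))
          ≈⟨ +-congˡ (·-cong (size i) (+-cong (≈-sym (length-rootPathTo a≤m i)) (⁻¹-cong (≈-sym (length-rootPathTo b≤m i))))) ⟩
        size i · dist b (position i) + size i · (Lw A γ (edgesW C (proj₁ (rootPathTo a≤m i))) - Lw A γ (edgesW C (proj₁ (rootPathTo b≤m i)))) ∎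
      ... | false = ≈-trans (≈-reflexive (cong (size i ·_) outside)) (≈-sym (identityʳ _))
        where
        outside : dist a (position i) ≡ dist b (position i)
        outside with position i ≤? lo | hi <? position i
        ... | yes p≤lo | _ = dist-below (ℕₚ.≤-trans p≤lo lo≤a) (ℕₚ.≤-trans p≤lo lo≤b)
        ... | no _ | yes hi<p = dist-above (ℕₚ.≤-<-trans a≤hi hi<p) (ℕₚ.≤-<-trans b≤hi hi<p)
        ... | no p≰lo | no hi≮p = case ≡.trans (≡.sym v∈l) (≡.subst (λ z → inList z l ≡ true) (vertex-index (just (v i)))
                                          (inList-∈ (between∈l (position i) (ℕₚ.≰⇒> p≰lo) (ℕₚ.≮⇒≥ hi≮p)))) of λ ()

    distSum-split : ∀ k lo d r → suc lo +ℕ (suc d +ℕ r) ≡ suc m →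
                    distSum k 0 (suc m) ≈ distSum k 0 (suc lo) + (distSum k (suc lo) (suc d) + distSum k (suc (d +ℕ suc lo)) r)
    distSum-split k lo d r total = begin
      sumA (map (dist k) (range 0 (suc m)))                  ≈⟨ ≈-reflexive (cong (λ l → sumA (map (dist k) l)) split) ⟩
      sumA (map (dist k) (range 0 (suc lo) ++ (range (suc lo) (suc d) ++ range (suc (d +ℕ suc lo)) r)))
        ≈⟨ sumA-map-++ (dist k) (range 0 (suc lo)) _ ⟩
      distSum k 0 (suc lo) + sumA (map (dist k) (range (suc lo) (suc d) ++ range (suc (d +ℕ suc lo)) r))
        ≈⟨ +-congˡ (sumA-map-++ (dist k) (range (suc lo) (suc d)) _) ⟩
      distSum k 0 (suc lo) + (distSum k (suc lo) (suc d) + distSum k (suc (d +ℕ suc lo)) r) ∎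
      where
      split : range 0 (suc m) ≡ range 0 (suc lo) ++ (range (suc lo) (suc d) ++ range (suc (d +ℕ suc lo)) r)
      split = ≡.trans (cong (range 0) (≡.sym total))
              (≡.trans (range-+ 0 (suc lo) (suc d +ℕ r))
              (cong (range 0 (suc lo) ++_) (≡.trans (cong (λ s → range s (suc d +ℕ r)) (ℕₚ.+-identityʳ (suc lo)))
                                                    (range-+ (suc lo) (suc d) r))))

    distSum-below : ∀ {a b lo} → lo ≤ℕ a → lo ≤ℕ b → distSum a 0 (suc lo) ≈ distSum b 0 (suc lo)
    distSum-below {a} {b} {lo} lo≤a lo≤b = sumA-cong (range 0 (suc lo)) λ x x∈ →
      let x≤lo = ℕₚ.≤-pred (≡.subst (x <ℕ_) (ℕₚ.+-identityʳ (suc lo)) (proj₂ (∈-range⁻ 0 (suc lo) x∈)))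
      in ≈-reflexive (dist-below (ℕₚ.≤-trans x≤lo lo≤a) (ℕₚ.≤-trans x≤lo lo≤b))

    distSum-above : ∀ {a b hi} r → a ≤ℕ hi → b ≤ℕ hi → distSum a (suc hi) r ≈ distSum b (suc hi) r
    distSum-above {a} {b} {hi} r a≤hi b≤hi = sumA-cong (range (suc hi) r) λ x x∈ →
      let hi<x = proj₁ (∈-range⁻ (suc hi) r x∈)
      in ≈-reflexive (dist-above (ℕₚ.≤-<-trans a≤hi hi<x) (ℕₚ.≤-<-trans b≤hi hi<x))

    private
      module Solver = Algebra.Solver.CommutativeMonoid +-commutativeMonoid

    difference-of-prefixSums : ∀ {Ma Mb L₁ L₂ C⁺ C⁻} d → Ma ≈ L₂ + (d · L₂ + C⁺) → Mb ≈ L₁ + (d · L₁ + C⁻) →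
                               Ma - Mb ≈ (L₂ - L₁) + d · (L₂ - L₁) + C⁺ - C⁻
    difference-of-prefixSums {Ma} {Mb} {L₁} {L₂} {C⁺} {C⁻} d Ma≈ Mb≈ = begin
      Ma - Mb                                                   ≈⟨ +-cong Ma≈ (⁻¹-cong Mb≈) ⟩
      (L₂ + (d · L₂ + C⁺)) - (L₁ + (d · L₁ + C⁻))               ≈⟨ +-congˡ (⁻¹-∙-comm L₁ _) ⟨
      (L₂ + (d · L₂ + C⁺)) + (- L₁ + - (d · L₁ + C⁻))           ≈⟨ +-congˡ (+-congˡ (⁻¹-∙-comm (d · L₁) C⁻)) ⟨
      (L₂ + (d · L₂ + C⁺)) + (- L₁ + (- (d · L₁) + - C⁻))       ≈⟨ regroup L₂ (d · L₂) C⁺ (- L₁) (- (d · L₁)) (- C⁻) ⟩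
      (L₂ - L₁) + (d · L₂ + - (d · L₁)) + C⁺ - C⁻               ≈⟨ +-congʳ (+-congʳ (+-congˡ (+-congˡ (·-neg d L₁)))) ⟨
      (L₂ - L₁) + (d · L₂ + d · (- L₁)) + C⁺ - C⁻               ≈⟨ +-congʳ (+-congʳ (+-congˡ (·-distrib-+ d L₂ (- L₁)))) ⟨
      (L₂ - L₁) + d · (L₂ - L₁) + C⁺ - C⁻ ∎
      where
      open Solver using (solve; _⊜_; _⊕_)
      regroup : ∀ a b c x y z → (a + (b + c)) + (x + (y + z)) ≈ (a + x) + (b + y) + c + z
      regroup = solve 6 (λ a b c x y z → (a ⊕ (b ⊕ c)) ⊕ (x ⊕ (y ⊕ z)) ⊜ (((a ⊕ x) ⊕ (b ⊕ y)) ⊕ c) ⊕ z) ≈-refl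

    -- The trees C − e_a and C − e_b differ only in the removed edge and in the depths of the arc between e_a and e_b.
    potential-difference :
      ∀ {a b S₁ S₃ Ma Mb HΣ} →
      distSum a 0 (suc m) ≈ S₁ + (Ma + S₃) → distSum b 0 (suc m) ≈ S₁ + (Mb + S₃) → hangingDist a ≈ hangingDist b + HΣ →
      potential a ≈ potential b + ((τ (edge b) - τ (edge a) + (Ma - Mb)) + HΣ)
    potential-difference {a} {b} {S₁} {S₃} {Ma} {Mb} {HΣ} Va≈ Vb≈ Ha≈ = ≈-sym (begin
      (Eb + (distSum b 0 (suc m) + Hb)) + ((τb - τa + (Ma - Mb)) + HΣ)
        ≈⟨ +-congʳ (+-congˡ (+-congʳ Vb≈)) ⟩
      (Eb + ((S₁ + (Mb + S₃)) + Hb)) + (((τb + - τa) + (Ma + - Mb)) + HΣ)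
        ≈⟨ regroup Eb S₁ Mb S₃ Hb τb (- τa) Ma (- Mb) HΣ ⟩
      ((Eb + τb) + - τa) + (((S₁ + (Ma + S₃)) + (Hb + HΣ)) + (Mb - Mb))
        ≈⟨ +-cong cancelτ (+-cong (+-cong (≈-sym Va≈) (≈-sym Ha≈)) (inverseʳ Mb)) ⟩
      Ea + ((distSum a 0 (suc m) + hangingDist a) + 0#)
        ≈⟨ +-congˡ (identityʳ _) ⟩
      potential a ∎)
      where
      open Solver using (solve; _⊜_; _⊕_)
      Ea = edgeCost-without (edge a)
      Eb = edgeCost-without (edge b)
      τa = τ (edge a)
      τb = τ (edge b)
      Hb = hangingDist b
      cancelτ : (Eb + τb) + - τa ≈ Ea
      cancelτ = begin
        (Eb + τb) + - τa   ≈⟨ +-congʳ (≈-trans (edgeCost-without+τ (edge b)) (≈-sym (edgeCost-without+τ (edge a)))) ⟩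
        (Ea + τa) + - τa   ≈⟨ assoc Ea τa (- τa) ⟩
        Ea + (τa - τa)     ≈⟨ +-congˡ (inverseʳ τa) ⟩
        Ea + 0#            ≈⟨ identityʳ Ea ⟩
        Ea ∎
      regroup : ∀ eb s₁ mb s₃ hb tb ta ma mb′ h →
                (eb + ((s₁ + (mb + s₃)) + hb)) + (((tb + ta) + (ma + mb′)) + h) ≈
                ((eb + tb) + ta) + (((s₁ + (ma + s₃)) + (hb + h)) + (mb + mb′))
      regroup = solve 10 (λ eb s₁ mb s₃ hb tb ta ma mb′ h →
                  (eb ⊕ ((s₁ ⊕ (mb ⊕ s₃)) ⊕ hb)) ⊕ (((tb ⊕ ta) ⊕ (ma ⊕ mb′)) ⊕ h) ⊜
                  ((eb ⊕ tb) ⊕ ta) ⊕ (((s₁ ⊕ (ma ⊕ s₃)) ⊕ (hb ⊕ h)) ⊕ (mb ⊕ mb′))) ≈-refl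

    module _ {a b} (a≤m : a ≤ℕ m) (b≤m : b ≤ℕ m) {b₁ b₂ : Maybe (Fin m)}
             (P₁ : Walk C (without (edge b)) nothing b₁) (P₁-path : IsPath C P₁) (P₁-last : last (edgesW C P₁) ≡ just (edge a))
             (P₂ : Walk C (without (edge a)) nothing b₂) (P₂-path : IsPath C P₂) (P₂-last : last (edgesW C P₂) ≡ just (edge b))
             (Q⁺ : Walk C (without₂ (edge a) (edge b)) b₂ b₁) (Q⁺-path : IsPath C Q⁺)
             (Q⁻ : Walk C (without₂ (edge a) (edge b)) b₁ b₂) (Q⁻-path : IsPath C Q⁻)
             {lo d r} (total : suc lo +ℕ (suc d +ℕ r) ≡ suc m)
             (lo≤a : lo ≤ℕ a) (lo≤b : lo ≤ℕ b) (a≤hi : a ≤ℕ d +ℕ suc lo) (b≤hi : b ≤ℕ d +ℕ suc lo) where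

      private
        L₁ = Lw A γ (edgesW C P₁)
        L₂ = Lw A γ (edgesW C P₂)
        ℓ = length (edgesW C Q⁺)

      exchange : distSum a (suc lo) (suc d) ≈ L₂ + (ℓ · L₂ + Cw A γ (edgesW C Q⁺)) →
                 distSum b (suc lo) (suc d) ≈ L₁ + (ℓ · L₁ + Cw A γ (edgesW C Q⁻)) →
                 (∀ x → lo <ℕ x → x ≤ℕ d +ℕ suc lo → vertex x ∈ vertsW C Q⁺) →
                 ExchangeCondition (edge a) (edge b) → potential a ≤ potential b
      exchange Ma≈ Mb≈ arc⊆Q⁺ condition =
        ≤-respˡ-≈ (≈-sym Φa≈) (≤-respʳ-≈ Φb≈ (+-monoʳ-≤ (potential b) excess≤0))
        where
        reassociate : ∀ t x y c c′ → t + (((x + y) + c) + c′) ≈ (((t + x) + y) + c) + c′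
        reassociate = solve 5 (λ t x y c c′ → t ⊕ (((x ⊕ y) ⊕ c) ⊕ c′) ⊜ (((t ⊕ x) ⊕ y) ⊕ c) ⊕ c′) ≈-refl
          where open Solver using (solve; _⊜_; _⊕_)
        excess≤0 = condition b₁ b₂ P₁ P₁-path P₁-last P₂ P₂-path P₂-last Q⁺ Q⁺-path Q⁻ Q⁻-path (rootPathTo a≤m) (rootPathTo b≤m)
        Φb≈ : potential b + 0# ≈ potential b
        Φb≈ = identityʳ (potential b)
        hanging = hangingDist-split a≤m b≤m lo≤a lo≤b a≤hi b≤hi (vertsW C Q⁺) arc⊆Q⁺
        Φa≈ = ≈-trans (potential-difference (distSum-split a lo d r total)
                        (≈-trans (distSum-split b lo d r total) (+-cong (distSum-below lo≤b lo≤a) (+-congˡ (distSum-above r b≤hi a≤hi))))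
                        hanging)
                      (+-congˡ (+-congʳ (≈-trans (+-congˡ (difference-of-prefixSums ℓ Ma≈ Mb≈)) (reassociate _ _ _ _ _))))

    open CyclePaths m

    distSum-arc-backward : ∀ {lo hi} → lo <ℕ hi → hi ≤ℕ m →
                           distSum lo (suc lo) (suc (hi ∸ suc lo)) ≈ prefixSums (dist lo hi) (map edge (rangeDown (suc lo) (hi ∸ suc lo)))
    distSum-arc-backward {lo} {hi} lo<hi hi≤m =
      sum-backward (dist lo) (suc lo) (hi ∸ suc lo) (dist lo hi) (≈-reflexive (cong (dist lo) hi≡))
        (λ i lo<i i<hi → dist-backward lo i lo<i (ℕₚ.≤-trans (≡.subst (i <ℕ_) hi≡ i<hi) hi≤m))
      where
      hi≡ = ℕₚ.m∸n+n≡m lo<hi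

    distSum-arc-forward : ∀ {lo hi} → lo <ℕ hi →
                          distSum hi (suc lo) (suc (hi ∸ suc lo)) ≈ prefixSums (dist hi (suc lo)) (map edge (range (suc lo) (hi ∸ suc lo)))
    distSum-arc-forward {lo} {hi} lo<hi =
      sum-forward (dist hi) (suc lo) (hi ∸ suc lo) (dist hi (suc lo)) ≈-refl
        (λ i _ i<hi → dist-forward hi i (≡.subst (i <ℕ_) (ℕₚ.m∸n+n≡m lo<hi) i<hi))

    prefixSums-walks : ∀ {X ℓ es} {x y u w : Vx C} {T T′} (P : Walk C T x y) (Q : Walk C T′ u w) {k} →
                       X ≈ prefixSums ℓ es → ℓ ≡ Lw A γ (edgesW C P) → es ≡ edgesW C Q → length (edgesW C Q) ≡ k →
                       X ≈ Lw A γ (edgesW C P) + (k · Lw A γ (edgesW C P) + Cw A γ (edgesW C Q))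
    prefixSums-walks P Q X≈ ≡.refl ≡.refl ≡.refl = ≈-trans X≈ (prefixSums≈ (Lw A γ (edgesW C P)) (edgesW C Q))

    -- Case e₁ before e₂: the arc between them is reached backwards in C − e₁ and forwards in C − e₂.
    potential-≤-forward : ∀ {a b} → a <ℕ b → b ≤ℕ m → ExchangeCondition (edge a) (edge b) → potential a ≤ potential b
    potential-≤-forward {a} {b} a<b b≤m =
      exchange a≤m b≤m P₁ (rootWalk-isPath b≤m a<m) (rootWalk-last-forward b≤m a<b)
                       P₂ (rootWalk-isPath a≤m b≤m) (rootWalk-last-backward a≤m b≤m a<b)
               arcDown arcDown-isPath arcUp arcUp-isPath
               (arc-total m a<b b≤m) ℕₚ.≤-refl (ℕₚ.<⇒≤ a<b) (ℕₚ.≤-trans (ℕₚ.<⇒≤ a<b) hi≥b) hi≥b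
               (prefixSums-walks P₂ arcDown (distSum-arc-backward a<b b≤m)
                  (cong (Lw A γ) (≡.sym (edgesW-rootWalk a≤m b≤m))) (≡.sym edgesW-arcDown) ≡.refl)
               (prefixSums-walks P₁ arcUp (distSum-arc-forward a<b)
                  (cong (Lw A γ) (≡.sym (edgesW-rootWalk b≤m a<m))) (≡.sym edgesW-arcUp) length-arcUp≡length-arcDown)
               (λ x a<x x≤hi → arc⊆arcDown a<x (ℕₚ.≤-trans x≤hi (ℕₚ.≤-reflexive arcLength+suc-lo)))
      where
      a<m = ℕₚ.≤-trans a<b b≤m
      a≤m = ℕₚ.<⇒≤ a<m
      arcOpen : ∀ {j} → suc a ≤ℕ j → j <ℕ b → without₂ (edge a) (edge b) (edge j) ≡ true
      arcOpen a<j j<b = let (j≢a , j≢b) = arc-avoids b≤m a<j j<b in without₂-true j≢a j≢b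
      open Arc a<b b≤m {without₂ (edge a) (edge b)} arcOpen
      hi≥b = ℕₚ.≤-reflexive (≡.sym arcLength+suc-lo)
      P₁ = rootWalk b≤m a<m
      P₂ = rootWalk a≤m b≤m

    potential-≤-backward : ∀ {a b} → b <ℕ a → a ≤ℕ m → ExchangeCondition (edge a) (edge b) → potential a ≤ potential b
    potential-≤-backward {a} {b} b<a a≤m =
      exchange a≤m b≤m P₁ (rootWalk-isPath b≤m a≤m) (rootWalk-last-backward b≤m a≤m b<a)
                       P₂ (rootWalk-isPath a≤m b<m) (rootWalk-last-forward a≤m b<a)
               arcUp arcUp-isPath arcDown arcDown-isPath
               (arc-total m b<a a≤m) (ℕₚ.<⇒≤ b<a) ℕₚ.≤-refl hi≥a (ℕₚ.≤-trans (ℕₚ.<⇒≤ b<a) hi≥a)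
               (prefixSums-walks P₂ arcUp (distSum-arc-forward b<a)
                  (cong (Lw A γ) (≡.sym (edgesW-rootWalk a≤m b<m))) (≡.sym edgesW-arcUp) ≡.refl)
               (prefixSums-walks P₁ arcDown (distSum-arc-backward b<a a≤m)
                  (cong (Lw A γ) (≡.sym (edgesW-rootWalk b≤m a≤m))) (≡.sym edgesW-arcDown) (≡.sym length-arcUp≡length-arcDown))
               (λ x b<x x≤hi → arc⊆arcUp b<x (ℕₚ.≤-trans x≤hi (ℕₚ.≤-reflexive arcLength+suc-lo)))
      where
      b<m = ℕₚ.≤-trans b<a a≤m
      b≤m = ℕₚ.<⇒≤ b<m
      arcOpen : ∀ {j} → suc b ≤ℕ j → j <ℕ a → without₂ (edge a) (edge b) (edge j) ≡ true
      arcOpen b<j j<a = let (j≢b , j≢a) = arc-avoids a≤m b<j j<a in without₂-true j≢a j≢b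
      open Arc b<a a≤m {without₂ (edge a) (edge b)} arcOpen
      hi≥a = ℕₚ.≤-reflexive (≡.sym arcLength+suc-lo)
      P₁ = rootWalk b≤m a≤m
      P₂ = rootWalk a≤m b<m

    potential-≤ : ∀ {a b} → a ≤ℕ m → b ≤ℕ m → a ≢ b → ExchangeCondition (edge a) (edge b) → potential a ≤ potential b
    potential-≤ {a} {b} a≤m b≤m a≢b with ℕₚ.<-cmp a b
    ... | tri< a<b _ _ = potential-≤-forward a<b b≤m
    ... | tri≈ _ a≡b _ = ⊥-elim (a≢b a≡b)
    ... | tri> _ _ b<a = potential-≤-backward b<a a≤m

    open TreeCost A

    module _ {T : E C → Bool} (st : IsSpanningTree C T) {k} (k≤m : k ≤ℕ m) (T≗ : ∀ e → T e ≡ without (edge k) e) where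

      depth-cycle : ∀ {x} → x ≤ℕ m → depth C γ st (vertex x) ≈ dist k x
      depth-cycle x≤m = ≈-trans (depth-path st (weaken C open′ (rootWalk k≤m x≤m)) (weaken-isPath C open′ (rootWalk k≤m x≤m) (rootWalk-isPath k≤m x≤m)))
                                (≈-reflexive (cong (Lw A γ) (≡.trans (edgesW-weaken C open′ (rootWalk k≤m x≤m)) (edgesW-rootWalk k≤m x≤m))))
        where
        open′ : ∀ e → without (edge k) e ≡ true → T e ≡ true
        open′ e t = ≡.trans (T≗ e) t

      cost+hanging≈potential : cost A C γ τ T st + sumA (map (λ i → size i · depth C γ st (just (v i))) (allFin n)) ≈ potential k
      cost+hanging≈potential = begin
        (edgeCost C τ T + sumA (map (depth C γ st) (verts C))) + sumA (map (λ i → size i · depth C γ st (just (v i))) (allFin n))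
          ≈⟨ +-cong (+-cong (≈-reflexive edgeCost≡) vertexDepths) hangingDepths ⟩
        (edgeCost-without (edge k) + distSum k 0 (suc m)) + hangingDist k
          ≈⟨ assoc _ _ _ ⟩
        potential k ∎
        where
        edgeCost≡ : edgeCost C τ T ≡ edgeCost-without (edge k)
        edgeCost≡ = cong sumA (map-cong (λ e → cong (λ b → if b then τ e else 0#) (T≗ e)) (allFin (suc m)))
        vertexDepths : sumA (map (depth C γ st) (verts C)) ≈ distSum k 0 (suc m)
        vertexDepths = begin
          sumA (map (depth C γ st) (verts C))                          ≈⟨ ≈-reflexive (cong (λ l → sumA (map (depth C γ st) l)) verts-cycle) ⟩
          sumA (map (depth C γ st) (map vertex (range 0 (suc m))))     ≈⟨ sumA-map (depth C γ st) vertex (range 0 (suc m)) ⟩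
          sumA (map (λ x → depth C γ st (vertex x)) (range 0 (suc m)))
            ≈⟨ sumA-cong (range 0 (suc m)) (λ x x∈ → depth-cycle (ℕₚ.≤-pred (≡.subst (x <ℕ_) (ℕₚ.+-identityʳ (suc m)) (proj₂ (∈-range⁻ 0 (suc m) x∈))))) ⟩
          distSum k 0 (suc m) ∎
        hangingDepths : sumA (map (λ i → size i · depth C γ st (just (v i))) (allFin n)) ≈ hangingDist k
        hangingDepths = sumA-cong (allFin n) λ i _ →
          ·-cong (size i) (≈-trans (≈-reflexive (cong (depth C γ st) (≡.sym (vertex-index (just (v i)))))) (depth-cycle (position≤m i)))

    potential-minimal : ∀ {e₁} → (∀ e₂ → e₂ ≢ e₁ → ExchangeCondition e₁ e₂) → ∀ e₂ → potential (toℕ e₁) ≤ potential (toℕ e₂)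
    potential-minimal {e₁} condition e₂ with toℕ e₁ ≟ℕ toℕ e₂
    ... | yes same = ≤-reflexive (≈-reflexive (cong potential same))
    ... | no differ = potential-≤ (toℕ≤pred[n] e₁) (toℕ≤pred[n] e₂) differ
      (≡.subst₂ ExchangeCondition (≡.sym (toEdge-toℕ m e₁)) (≡.sym (toEdge-toℕ m e₂))
                (condition e₂ (λ e₂≡e₁ → differ (cong toℕ (≡.sym e₂≡e₁)))))

  module WedgeOverCycle (A : OrderedAbelianGroup) (m : ℕ) (γ τ : Fin (suc m) → OrderedAbelianGroup.Carrier A)
                        {n : ℕ} (H : Fin n → RGraph) (v : Fin n → Fin m)
                        (γH τH : ∀ i → E (H i) → OrderedAbelianGroup.Carrier A) where

    open OrderedAbelianGroupProperties A
    open CycleGeometry m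
    open WedgeTrees C H v
    open WedgeCostDecomposition A C H v γ τ γH τH public using (γʷ; τʷ; wedge-cost)
    open Potential A m γ τ v (λ i → length (nonroot (H i))) public

    partCosts : ∀ T′ → (∀ i → IsSpanningTree (H i) (restrictH T′ i)) → Carrier
    partCosts T′ stH = sumA (map (λ i → cost A (H i) (γH i) (τH i) (restrictH T′ i) (stH i)) (allFin n))

    wedge-cost≈potential : ∀ T′ (st′ : IsSpanningTree Gʷ T′) stG stH k → (∀ e → restrictG T′ e ≡ without k e) →
                           cost A Gʷ γʷ τʷ T′ st′ ≈ potential (toℕ k) + partCosts T′ stH
    wedge-cost≈potential T′ st′ stG stH k T′≗ =
      ≈-trans (wedge-cost T′ st′ stG stH)
              (≈-trans (≈-sym (assoc _ _ _)) (+-congʳ (cost+hanging≈potential stG (toℕ≤pred[n] k) (without-edge-toℕ k T′≗))))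

open import Data.Nat using (z≤n; s≤s)
import Data.Nat.Properties as ℕₚ
open import Data.Fin.Properties using () renaming (_≟_ to _≟F_)
open import Data.Product using (_,_; proj₂)
open import Relation.Binary.PropositionalEquality using (refl)

open Walks
open Wedge
open Sums
open WedgeCost
open Cycle
open CycleCost
open Exchange

theorem1 : (A : OrderedAbelianGroup) → let open OrderedAbelianGroup A in
    (m : ℕ) → 2 ≤ℕ m →
    (γ τ : Fin (suc m) → Carrier) (e₁ : Fin (suc m)) →
    IsCableTrench A (cycleGraph m) γ τ (without e₁) →
    (n : ℕ) (v : Fin n → Fin m) → ((i j : Fin n) → v i ≡ v j → i ≡ j) →
    (H : Fin n → RGraph) → ((i : Fin n) → WellFormed (H i)) → ((i : Fin n) → Simple (H i)) →
    (γH τH : (i : Fin n) → E (H i) → Carrier) →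
    (S : (i : Fin n) → E (H i) → Bool) →
    ((i : Fin n) → IsCableTrench A (H i) (γH i) (τH i) (S i)) →
    ((e₂ : Fin (suc m)) → e₂ ≢ e₁ →
      (b₁ b₂ : Maybe (Fin m)) →
      (P₁ : Walk (cycleGraph m) (without e₂) nothing b₁) → IsPath (cycleGraph m) P₁ →
      last (edgesW (cycleGraph m) P₁) ≡ just e₁ →
      (P₂ : Walk (cycleGraph m) (without e₁) nothing b₂) → IsPath (cycleGraph m) P₂ →
      last (edgesW (cycleGraph m) P₂) ≡ just e₂ →
      (Q⁺ : Walk (cycleGraph m) (without₂ e₁ e₂) b₂ b₁) → IsPath (cycleGraph m) Q⁺ →
      (Q⁻ : Walk (cycleGraph m) (without₂ e₁ e₂) b₁ b₂) → IsPath (cycleGraph m) Q⁻ →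
      (R₁ : (j : Fin n) → Σ (Walk (cycleGraph m) (without e₁) nothing (just (v j))) (IsPath (cycleGraph m))) →
      (R₂ : (j : Fin n) → Σ (Walk (cycleGraph m) (without e₂) nothing (just (v j))) (IsPath (cycleGraph m))) →
      τ e₂ - τ e₁
        + (Lw A γ (edgesW (cycleGraph m) P₂) - Lw A γ (edgesW (cycleGraph m) P₁))
        + length (edgesW (cycleGraph m) Q⁺)
            · (Lw A γ (edgesW (cycleGraph m) P₂) - Lw A γ (edgesW (cycleGraph m) P₁))
        + Cw A γ (edgesW (cycleGraph m) Q⁺) - Cw A γ (edgesW (cycleGraph m) Q⁻)
        + sumA (map (λ j → if inList (just (v j)) (vertsW (cycleGraph m) Q⁺)
                             then length (nonroot (H j))
                                    · (Lw A γ (edgesW (cycleGraph m) (proj₁ (R₁ j)))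
                                       - Lw A γ (edgesW (cycleGraph m) (proj₁ (R₂ j))))
                             else 0#)
                    (allFin n))
        ≤ 0#) →
    IsCableTrench A (wedge (cycleGraph m) H v)
      (wedgeW (cycleGraph m) H v γ γH) (wedgeW (cycleGraph m) H v τ τH)
      (wedgeTree (cycleGraph m) H v (without e₁) S)
theorem1 A m 2≤m γ τ e₁ (st₁ , _) n v v-injective H wellFormed _ γH τH S optimalH condition = st★ , minimal
  where
  open OrderedAbelianGroupProperties A
  open CycleGeometry m
  open WedgeTrees C H v
  open WedgeOverCycle A m γ τ H v γH τH

  T★ = wedgeTree C H v (without e₁) S
  stS : ∀ i → IsSpanningTree (H i) (S i)
  stS i = proj₁ (optimalH i)
  st★ : IsSpanningTree Gʷ T★
  st★ = wedge-isSpanningTree T★ st₁ stS v-injective _≟F_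
          (λ i → decidableEquality-fromEnumeration (nonroot (H i)) (proj₁ (proj₂ (wellFormed i))) (proj₁ (wellFormed i)))

  minimal : ∀ T′ (st′ : IsSpanningTree Gʷ T′) → cost A Gʷ γʷ τʷ T★ st★ ≤ cost A Gʷ γʷ τʷ T′ st′
  minimal T′ st′ with cycle-spanningTree (restrictG-isSpanningTree T′ st′) (ℕₚ.≤-trans (s≤s z≤n) 2≤m)
  ... | e₂ , T′≗ =
    ≤-respˡ-≈ (≈-sym (wedge-cost≈potential T★ st★ st₁ stS e₁ (λ _ → refl)))
      (≤-respʳ-≈ (≈-sym (wedge-cost≈potential T′ st′ (restrictG-isSpanningTree T′ st′) stH′ e₂ T′≗))
        (+-mono-≤ (potential-minimal condition e₂)
                  (sumA-mono _ _ (allFin n) (λ i → proj₂ (optimalH i) (restrictH T′ i) (stH′ i)))))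
    where
    stH′ = restrictH-isSpanningTree T′ st′
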